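{- Let $d\ge 0$, $m=2^d$, and $1\le k\le m$. Every $(k,m)$-affine necklace is a $(k,m)$-nested perfect necklace.
   Context: Words are finite sequences over $\mathbb{F}_2=\{0,1\}$; positions are numbered from $1$. A word $a_1\cdots a_n$ is identified with the column vector $(a_1,\dots,a_n)^t\in\mathbb{F}_2^n$, and $\oplus$ denotes componentwise addition modulo $2$. For a word $v$ of length $L$ and $k\le L$, a word $u$ of length $k$ occurs cyclically in $v$ at position $j$ ($1\le j\le L$) if $u$ is the factor of $vv$ of length $k$ starting at position $j$. A binary word $v$ of length $m2^k$ is a $(k,m)$-perfect necklace if every word $u$ of length $k$ occurs cyclically in $v$ exactly $m$ times, at starting positions pairwise incongruent modulo $m$. A binary word $w$ of length $m2^k$ is a $(k,m)$-nested perfect necklace if for each $\ell=1,\dots,k$, every factor of $w$ of length $m2^\ell$ starting at a position congruent to $1$ modulo $m2^\ell$ is an $(\ell,m)$-perfect necklace. Matrices: $M_0=(1)$, $M_{d+1}=\begin{pmatrix}M_d&M_d\\0&M_d\end{pmatrix}$ over $\mathbb{F}_2$. Let $\sigma$ map $a_1\cdots a_n$ to $a_na_1\cdots a_{n-1}$ (also on column vectors). For integers $n_1,\dots,n_m$ with $n_m=0$ and $n_{i+1}\le n_i\le n_{i+1}+1$ ($1\le i<m$), and $C_1,\dots,C_m$ the columns of $M_d$, set $M_d^{n_1,\dots,n_m}=(\sigma^{n_1}(C_1),\dots,\sigma^{n_m}(C_m))$. Let $w_1,\dots,w_{2^m}$ be all binary words of length $m$ in lexicographic order. A $(k,m)$-affine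 necklace is a word $(Mw'_1)(Mw'_2)\cdots(Mw'_{2^k})$ where $M$ is some $M_d^{n_1,\dots,n_m}$, $z$ is a binary word of length $m$, and $w'_i=w_i\oplus z$. -}

module Defs where

open import Data.Bool using (Bool; true; false; if_then_else_; _xor_; _∧_)
open import Data.Nat using (ℕ; zero; suc; _+_; _*_; _∸_; _^_; _≤_; _<_; _<ᵇ_; ∣_-_∣)
open import Data.Nat.Divisibility using (_∣_)
open import Data.Fin using (Fin; toℕ)
open import Data.Vec using (Vec; []; _∷_; last; init; tabulate; lookup; zipWith; toList)
open import Data.List as List using (List; [_]; _++_; map; take; drop; filter; upTo; length; concatMap)
open import Data.List.Properties using (≡-dec)
open import Data.List.Relation.Unary.AllPairs using (AllPairs)
open import Data.Product using (_×_)
open import Relation.Nullary using (¬_)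
open import Relation.Binary.PropositionalEquality using (_≡_)
import Data.Bool.Properties as BoolP

-- Binary words are lists/vectors over Bool (false = 0, true = 1).
Word : Set
Word = List Bool

occursAt? : (v u : Word) (j : ℕ) → _
occursAt? v u j = ≡-dec BoolP._≟_ (take (length u) (drop j (v ++ v))) u

occurrences : Word → Word → List ℕ
occurrences v u = filter (occursAt? v u) (upTo (length v))

Incongruent : ℕ → ℕ → ℕ → Set
Incongruent m i j = ¬ (m ∣ ∣ i - j ∣)

PerfectNecklace : ℕ → ℕ → Word → Set
PerfectNecklace k m v =
  length v ≡ m * 2 ^ k ×
  ((u : Word) → length u ≡ k →
     length (occurrences v u) ≡ m × AllPairs (Incongruent m) (occurrences v u))

-- (k,m)-nested perfect necklace: the factor starting at (0-indexed)
-- position t·m2^ℓ (i.e. 1-indexed position ≡ 1 mod m2^ℓ) of length m2^ℓ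
-- is an (ℓ,m)-perfect necklace, for every 1 ≤ ℓ ≤ k.
NestedPerfectNecklace : ℕ → ℕ → Word → Set
NestedPerfectNecklace k m w =
  length w ≡ m * 2 ^ k ×
  ((ℓ : ℕ) → 1 ≤ ℓ → ℓ ≤ k → (t : ℕ) →
     t * (m * 2 ^ ℓ) + m * 2 ^ ℓ ≤ length w →
     PerfectNecklace ℓ m (take (m * 2 ^ ℓ) (drop (t * (m * 2 ^ ℓ)) w)))

-- M_0 = (1),  M_{d+1} = [[M_d, M_d], [0, M_d]]
Mentry : ℕ → ℕ → ℕ → Bool
Mentry zero    i j = true
Mentry (suc d) i j =
  if i <ᵇ 2 ^ d
  then (if j <ᵇ 2 ^ d then Mentry d i j else Mentry d i (j ∸ 2 ^ d))
  else (if j <ᵇ 2 ^ d then false else Mentry d (i ∸ 2 ^ d) (j ∸ 2 ^ d))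

column : (d : ℕ) → Fin (2 ^ d) → Vec Bool (2 ^ d)
column d j = tabulate (λ i → Mentry d (toℕ i) (toℕ j))

σ : ∀ {n} → Vec Bool n → Vec Bool n
σ {zero}  []       = []
σ {suc n} xs       = last xs ∷ init xs

σ^ : ∀ {n} → ℕ → Vec Bool n → Vec Bool n
σ^ zero    xs = xs
σ^ (suc r) xs = σ (σ^ r xs)

-- admissible exponents (n_1,…,n_m), given 0-indexed: ns i = n_{i+1}
Admissible : ℕ → (ℕ → ℕ) → Set
Admissible m ns =
  ns (m ∸ 1) ≡ 0 ×
  ((i : ℕ) → suc i < m → ns (suc i) ≤ ns i × ns i ≤ suc (ns (suc i)))

shiftedColumn : (d : ℕ) → (ℕ → ℕ) → Fin (2 ^ d) → Vec Bool (2 ^ d)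
shiftedColumn d ns j = σ^ (ns (toℕ j)) (column d j)

xorSum : ∀ {n} → Vec Bool n → Bool
xorSum []       = false
xorSum (x ∷ xs) = x xor xorSum xs

mulCols : ∀ {n} → (Fin n → Vec Bool n) → Vec Bool n → Vec Bool n
mulCols cols w = tabulate (λ r → xorSum (tabulate (λ j → lookup (cols j) r ∧ lookup w j)))

_⊕_ : ∀ {n} → Vec Bool n → Vec Bool n → Vec Bool n
_⊕_ = zipWith _xor_

allWords : (n : ℕ) → List (Vec Bool n)
allWords zero    = [ [] ]
allWords (suc n) = map (false ∷_) (allWords n) ++ map (true ∷_) (allWords n)

-- (Mw'_1)(Mw'_2)⋯(Mw'_{2^k}) with M = M_d^{ns}, w'_i = w_i ⊕ z
affineNecklace : (d k : ℕ) → (ℕ → ℕ) → Vec Bool (2 ^ d) → Word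
affineNecklace d k ns z =
  concatMap (λ w → toList (mulCols (shiftedColumn d ns) (w ⊕ z)))
            (take (2 ^ k) (allWords (2 ^ d)))

{-# OPTIONS --safe #-}

-- Over F₂, row x of column 2^d - 1 - b of M_d is binom (x + b) b (Lucas), and
-- rotating that column by n_{2^d - b} shifts the row index; admissibility makes
-- the shifts τ b = b - n_{2^d - b} a staircase (τ 0 = 0, steps of 0 or 1).  So
-- row i of a block M w′ is, up to a constant coming from z, the Pascal sum
-- ⊕_b w_b binom (i + τ b) b over the bits of the block index.  In the factor at
-- t·m2^ℓ the block indices are 2^ℓ t + s with s < 2^ℓ: every block is a fixed
-- vector plus the Pascal sum of the ℓ low bits of s.  Such a factor is perfect
-- as soon as the windows of length ℓ starting in one residue class mod m are
-- pairwise distinct, and they are: finite differences in i (Pascal's rule) peel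
-- off the bits of s one at a time.  A window running into the next block sees
-- the bits of s + 1 instead; there the staircase pays for every lost position
-- with a value known to vanish in row 0 or row 2^d.

module Submission where

open import Defs
open import Data.Bool using (Bool; true; false; _xor_; _∧_; if_then_else_)
open import Data.Bool.Properties
  using (xor-same; xor-identityʳ; xor-assoc; xor-comm; ∧-identityʳ; ∧-zeroʳ; ∧-assoc; ∧-comm; ∧-distribˡ-xor;
         xor-∧-commutativeRing)
open import Data.Nat
open import Data.Nat.Properties
open import Data.Nat.DivMod using (_/_; _%_; m≡m%n+[m/n]*n; m%n<n; %-remove-+ʳ; m<n*o⇒m/o<n)
open import Data.Nat.Divisibility using (_∣_)
open import Data.Nat.Solver using (module +-*-Solver)
open import Data.List as List using (List; []; _∷_; length; _++_; map; take; drop; filter; applyUpTo; upTo)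
open import Data.List.Properties using (length-++; length-map; length-take; length-drop; ∷-injectiveˡ; ∷-injectiveʳ)
open import Data.List.Relation.Unary.All as All using (All; []; _∷_)
open import Data.List.Relation.Unary.All.Properties using (all-filter)
open import Data.List.Relation.Unary.AllPairs using (AllPairs; []; _∷_)
open import Data.List.Relation.Unary.AllPairs.Properties using (filter⁺; applyUpTo⁺₁)
open import Data.Vec as Vec using (Vec; []; _∷_; lookup; tabulate; toList; _∷ʳ_; initLast)
open import Data.Vec.Properties using (lookup∘tabulate; length-toList)
open import Data.Fin as Fin using (Fin; toℕ; fromℕ<; punchOut)
open import Data.Fin.Properties using (toℕ-fromℕ<; toℕ-injective; toℕ<n; any?; punchOut-injective; injective⇒≤)
open import Data.Product using (_×_; _,_; proj₁; proj₂; ∃)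
open import Data.Sum using (_⊎_; inj₁; inj₂)
open import Data.Empty using (⊥-elim)
open import Function using (_∘_)
open import Relation.Nullary using (Dec; yes; no; does; ¬_)
open import Relation.Unary using (Decidable)
open import Relation.Binary.PropositionalEquality
open import Algebra.Bundles using (CommutativeRing)
open import Algebra.Properties.CommutativeSemigroup (CommutativeRing.+-commutativeSemigroup xor-∧-commutativeRing)
  using () renaming (interchange to xor-interchange)
open import Algebra.Properties.CommutativeSemigroup +-commutativeSemigroup
  using () renaming (interchange to +-interchange)
open import Algebra.Properties.Group (CommutativeRing.+-group xor-∧-commutativeRing)
  using () renaming (∙-cancelˡ to xor-cancelˡ; ∙-cancelʳ to xor-cancelʳ)

open +-*-Solver using (solve; _:+_; _:*_; _:=_; con)

double : ℕ → ℕ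
double zero    = zero
double (suc n) = suc (suc (double n))

double≡+ : ∀ n → double n ≡ n + n
double≡+ zero    = refl
double≡+ (suc n) = cong suc (trans (cong suc (double≡+ n)) (sym (+-suc n n)))

bitValue : Bool → ℕ
bitValue false = 0
bitValue true  = 1

lsb : ℕ → Bool
lsb zero          = false
lsb (suc zero)    = true
lsb (suc (suc n)) = lsb n

lsb+double-⌊/2⌋ : ∀ n → bitValue (lsb n) + double ⌊ n /2⌋ ≡ n
lsb+double-⌊/2⌋ zero          = refl
lsb+double-⌊/2⌋ (suc zero)    = refl
lsb+double-⌊/2⌋ (suc (suc n)) =
  trans (+-suc (bitValue (lsb n)) _) (cong suc (trans (+-suc (bitValue (lsb n)) _) (cong suc (lsb+double-⌊/2⌋ n))))

lsb-bit+double : ∀ b n → lsb (bitValue b + double n) ≡ b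
lsb-bit+double false zero    = refl
lsb-bit+double true  zero    = refl
lsb-bit+double false (suc n) = lsb-bit+double false n
lsb-bit+double true  (suc n) = lsb-bit+double true n

⌊bit+double/2⌋ : ∀ b n → ⌊ bitValue b + double n /2⌋ ≡ n
⌊bit+double/2⌋ false zero    = refl
⌊bit+double/2⌋ true  zero    = refl
⌊bit+double/2⌋ false (suc n) = cong suc (⌊bit+double/2⌋ false n)
⌊bit+double/2⌋ true  (suc n) = cong suc (⌊bit+double/2⌋ true n)

⌊/2⌋-< : ∀ n M → n < 2 * M → ⌊ n /2⌋ < M
⌊/2⌋-< n M n<2M = *-cancelˡ-< 2 ⌊ n /2⌋ M (≤-<-trans 2⌊n/2⌋≤n n<2M)
  where
  2⌊n/2⌋≤n : 2 * ⌊ n /2⌋ ≤ n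
  2⌊n/2⌋≤n = begin
    2 * ⌊ n /2⌋                          ≡⟨ cong (⌊ n /2⌋ +_) (+-identityʳ _) ⟩
    ⌊ n /2⌋ + ⌊ n /2⌋                    ≡⟨ double≡+ ⌊ n /2⌋ ⟨
    double ⌊ n /2⌋                       ≤⟨ m≤n+m _ (bitValue (lsb n)) ⟩
    bitValue (lsb n) + double ⌊ n /2⌋    ≡⟨ lsb+double-⌊/2⌋ n ⟩
    n                                    ∎
    where open ≤-Reasoning

2^suc*q+j≡lsb+double : ∀ d q j → 2 ^ suc d * q + j ≡ bitValue (lsb j) + double (2 ^ d * q + ⌊ j /2⌋)
2^suc*q+j≡lsb+double d q j = begin
  2 * M * q + j
    ≡⟨ cong (2 * M * q +_) (lsb+double-⌊/2⌋ j) ⟨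
  2 * M * q + (e + double h)
    ≡⟨ cong (λ x → 2 * M * q + (e + x)) (double≡+ h) ⟩
  2 * M * q + (e + (h + h))
    ≡⟨ solve 4 (λ M q e h → con 2 :* M :* q :+ (e :+ (h :+ h)) := e :+ ((M :* q :+ h) :+ (M :* q :+ h))) refl M q e h ⟩
  e + ((M * q + h) + (M * q + h))
    ≡⟨ cong (e +_) (double≡+ (M * q + h)) ⟨
  e + double (M * q + h)
    ∎
  where
  open ≡-Reasoning
  M = 2 ^ d
  e = bitValue (lsb j)
  h = ⌊ j /2⌋

2^suc≡double : ∀ n → 2 ^ suc n ≡ double (2 ^ n)
2^suc≡double n = trans (cong (2 ^ n +_) (+-identityʳ (2 ^ n))) (sym (double≡+ (2 ^ n)))

n<2^n : ∀ n → n < 2 ^ n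
n<2^n zero    = z<s
n<2^n (suc n) = begin-strict
  suc n            ≤⟨ n<2^n n ⟩
  2 ^ n            <⟨ m<m+n (2 ^ n) (m^n>0 2 n) ⟩
  2 ^ n + 2 ^ n    ≡⟨ cong (2 ^ n +_) (+-identityʳ (2 ^ n)) ⟨
  2 ^ suc n        ∎
  where open ≤-Reasoning

∸≡suc∸1∸ : ∀ {n b} → b < n → n ∸ b ≡ suc (n ∸ 1 ∸ b)
∸≡suc∸1∸ {n} {b} b<n = trans (+-∸-assoc 1 b<n) (cong suc (sym (∸-+-assoc n 1 b)))

∸1∸-< : ∀ {m} b → 0 < m → m ∸ 1 ∸ b < m
∸1∸-< {suc m} b _ = s≤s (m∸n≤m m b)

2^∸1∸-< : ∀ d b → 2 ^ d ∸ 1 ∸ b < 2 ^ d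
2^∸1∸-< d b = ∸1∸-< b (m^n>0 2 d)

<ᵇ-true : ∀ {m n} → m < n → (m <ᵇ n) ≡ true
<ᵇ-true {zero}  {suc n} _         = refl
<ᵇ-true {suc m} {suc n} (s≤s m<n) = <ᵇ-true m<n

<ᵇ-false : ∀ {m n} → n ≤ m → (m <ᵇ n) ≡ false
<ᵇ-false {m}     {zero}  _         = refl
<ᵇ-false {suc m} {suc n} (s≤s n≤m) = <ᵇ-false n≤m

data Halves (M : ℕ) : ℕ → Set where
  lower : ∀ {x} → x < M → Halves M x
  upper : ∀ {x} → x < M → Halves M (M + x)

halves : ∀ d {x} → x < 2 ^ suc d → Halves (2 ^ d) x
halves d {x} x<2M with x <? 2 ^ d
... | yes x<M = lower x<M
... | no  x≮M = subst (Halves M) (m+[n∸m]≡n M≤x) (upper (+-cancelˡ-< M (x ∸ M) M x∸M<M))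
  where
  M = 2 ^ d
  M≤x : M ≤ x
  M≤x = ≮⇒≥ x≮M
  x∸M<M : M + (x ∸ M) < M + M
  x∸M<M = subst₂ _<_ (sym (m+[n∸m]≡n M≤x)) (cong (M +_) (+-identityʳ M)) x<2M

+-<-2^suc : ∀ d {x y} → x < 2 ^ d → y < 2 ^ d → x + y < 2 ^ suc d
+-<-2^suc d {x} {y} x<M y<M = subst (x + y <_) (cong (2 ^ d +_) (sym (+-identityʳ (2 ^ d)))) (+-mono-< x<M y<M)

complement-lower : ∀ d {b} → b < 2 ^ d → 2 ^ suc d ∸ 1 ∸ b ≡ 2 ^ d + (2 ^ d ∸ 1 ∸ b)
complement-lower d {b} b<M = begin
  2 ^ suc d ∸ 1 ∸ b    ≡⟨ ∸-+-assoc (2 ^ suc d) 1 b ⟩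
  M + (M + 0) ∸ suc b  ≡⟨ cong (λ n → M + n ∸ suc b) (+-identityʳ M) ⟩
  M + M ∸ suc b        ≡⟨ +-∸-assoc M b<M ⟩
  M + (M ∸ suc b)      ≡⟨ cong (M +_) (∸-+-assoc M 1 b) ⟨
  M + (M ∸ 1 ∸ b)      ∎
  where
  open ≡-Reasoning
  M = 2 ^ d

complement-upper : ∀ d b → 2 ^ suc d ∸ 1 ∸ (2 ^ d + b) ≡ 2 ^ d ∸ 1 ∸ b
complement-upper d b = begin
  2 ^ suc d ∸ 1 ∸ (M + b)    ≡⟨ ∸-+-assoc (2 ^ suc d) 1 (M + b) ⟩
  M + (M + 0) ∸ suc (M + b)  ≡⟨ cong₂ (λ n o → M + n ∸ o) (+-identityʳ M) (sym (+-suc M b)) ⟩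
  M + M ∸ (M + suc b)        ≡⟨ [m+n]∸[m+o]≡n∸o M M (suc b) ⟩
  M ∸ suc b                  ≡⟨ ∸-+-assoc M 1 b ⟨
  M ∸ 1 ∸ b                  ∎
  where
  open ≡-Reasoning
  M = 2 ^ d

≤-≤suc⇒≡⊎≡suc : ∀ {a c} → a ≤ c → c ≤ suc a → c ≡ a ⊎ c ≡ suc a
≤-≤suc⇒≡⊎≡suc a≤c c≤1+a with m≤n⇒m<n∨m≡n c≤1+a
... | inj₁ c<1+a = inj₁ (≤-antisym (s≤s⁻¹ c<1+a) a≤c)
... | inj₂ c≡1+a = inj₂ c≡1+a

-- Binomial coefficients modulo 2

binom₂ : ℕ → ℕ → Bool
binom₂ zero    zero    = true
binom₂ zero    (suc k) = false
binom₂ (suc n) zero    = true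
binom₂ (suc n) (suc k) = binom₂ n k xor binom₂ n (suc k)

binom₂-zeroʳ : ∀ n → binom₂ n 0 ≡ true
binom₂-zeroʳ zero    = refl
binom₂-zeroʳ (suc n) = refl

binom₂-< : ∀ {n k} → n < k → binom₂ n k ≡ false
binom₂-< {zero}  {suc k} _         = refl
binom₂-< {suc n} {suc k} (s≤s n<k) =
  cong₂ _xor_ (binom₂-< n<k) (binom₂-< (m≤n⇒m≤1+n n<k))

mutual
  binom₂-even-even : ∀ n k → binom₂ (double n) (double k) ≡ binom₂ n k
  binom₂-even-even zero    zero    = refl
  binom₂-even-even zero    (suc k) = refl
  binom₂-even-even (suc n) zero    = refl
  binom₂-even-even (suc n) (suc k) =
    cong₂ _xor_ (binom₂-odd-odd n k) (binom₂-odd-even n (suc k))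

  binom₂-even-odd : ∀ n k → binom₂ (double n) (suc (double k)) ≡ false
  binom₂-even-odd zero    k = refl
  binom₂-even-odd (suc n) k =
    trans (cong₂ _xor_ (binom₂-odd-even n k) (binom₂-odd-odd n k)) (xor-same (binom₂ n k))

  binom₂-odd-even : ∀ n k → binom₂ (suc (double n)) (double k) ≡ binom₂ n k
  binom₂-odd-even zero    zero    = refl
  binom₂-odd-even zero    (suc k) = refl
  binom₂-odd-even (suc n) zero    = refl
  binom₂-odd-even (suc n) (suc k) =
    cong₂ _xor_ (binom₂-even-odd (suc n) k) (binom₂-even-even (suc n) (suc k))

  binom₂-odd-odd : ∀ n k → binom₂ (suc (double n)) (suc (double k)) ≡ binom₂ n k
  binom₂-odd-odd zero    zero    = refl
  binom₂-odd-odd zero    (suc k) = refl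
  binom₂-odd-odd (suc n) k =
    trans (cong₂ _xor_ (binom₂-even-even (suc n) k) (binom₂-even-odd (suc n) k))
          (xor-identityʳ (binom₂ (suc n) k))

binom₂-lucas-bit : ∀ e f n k →
  binom₂ (bitValue e + double n) (bitValue f + double k) ≡ binom₂ n k ∧ binom₂ (bitValue e) (bitValue f)
binom₂-lucas-bit false false n k = trans (binom₂-even-even n k) (sym (∧-identityʳ _))
binom₂-lucas-bit false true  n k = trans (binom₂-even-odd n k) (sym (∧-zeroʳ _))
binom₂-lucas-bit true  false n k = trans (binom₂-odd-even n k) (sym (∧-identityʳ _))
binom₂-lucas-bit true  true  n k = trans (binom₂-odd-odd n k) (sym (∧-identityʳ _))

binom₂-lucas : ∀ d q p j i → j < 2 ^ d → i < 2 ^ d →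
  binom₂ (2 ^ d * q + j) (2 ^ d * p + i) ≡ binom₂ q p ∧ binom₂ j i
binom₂-lucas zero    q p zero    zero    _         _         =
  trans (cong₂ binom₂ (1*x+0≡x q) (1*x+0≡x p)) (sym (∧-identityʳ _))
  where
  1*x+0≡x : ∀ x → 1 * x + 0 ≡ x
  1*x+0≡x x = trans (+-identityʳ _) (*-identityˡ x)
binom₂-lucas zero    q p (suc j) i       (s≤s ())  _
binom₂-lucas zero    q p zero    (suc i) _         (s≤s ())
binom₂-lucas (suc d) q p j i j<2M i<2M = begin
  binom₂ (2 ^ suc d * q + j) (2 ^ suc d * p + i)
    ≡⟨ cong₂ binom₂ (2^suc*q+j≡lsb+double d q j) (2^suc*q+j≡lsb+double d p i) ⟩
  binom₂ (bitValue (lsb j) + double (M * q + ⌊ j /2⌋)) (bitValue (lsb i) + double (M * p + ⌊ i /2⌋))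
    ≡⟨ binom₂-lucas-bit (lsb j) (lsb i) _ _ ⟩
  binom₂ (M * q + ⌊ j /2⌋) (M * p + ⌊ i /2⌋) ∧ binom₂ (bitValue (lsb j)) (bitValue (lsb i))
    ≡⟨ cong (_∧ _) (binom₂-lucas d q p ⌊ j /2⌋ ⌊ i /2⌋ (⌊/2⌋-< j M j<2M) (⌊/2⌋-< i M i<2M)) ⟩
  (binom₂ q p ∧ binom₂ ⌊ j /2⌋ ⌊ i /2⌋) ∧ binom₂ (bitValue (lsb j)) (bitValue (lsb i))
    ≡⟨ ∧-assoc (binom₂ q p) _ _ ⟩
  binom₂ q p ∧ (binom₂ ⌊ j /2⌋ ⌊ i /2⌋ ∧ binom₂ (bitValue (lsb j)) (bitValue (lsb i)))
    ≡⟨ cong (binom₂ q p ∧_) (binom₂-lucas-bit (lsb j) (lsb i) _ _) ⟨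
  binom₂ q p ∧ binom₂ (bitValue (lsb j) + double ⌊ j /2⌋) (bitValue (lsb i) + double ⌊ i /2⌋)
    ≡⟨ cong₂ (λ x y → binom₂ q p ∧ binom₂ x y) (lsb+double-⌊/2⌋ j) (lsb+double-⌊/2⌋ i) ⟩
  binom₂ q p ∧ binom₂ j i
    ∎
  where
  open ≡-Reasoning
  M = 2 ^ d

binom₂-low : ∀ d q {j k} → j < 2 ^ d → k < 2 ^ d → binom₂ (2 ^ d * q + j) k ≡ binom₂ j k
binom₂-low d q {j} {k} j<M k<M = begin
  binom₂ (2 ^ d * q + j) k             ≡⟨ cong (binom₂ (2 ^ d * q + j)) (cong (_+ k) (*-zeroʳ (2 ^ d))) ⟨
  binom₂ (2 ^ d * q + j) (2 ^ d * 0 + k) ≡⟨ binom₂-lucas d q 0 j k j<M k<M ⟩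
  binom₂ q 0 ∧ binom₂ j k              ≡⟨ cong (_∧ binom₂ j k) (binom₂-zeroʳ q) ⟩
  binom₂ j k                           ∎
  where open ≡-Reasoning

binom₂-periodic : ∀ d N {k} → k < 2 ^ d → binom₂ (2 ^ d + N) k ≡ binom₂ N k
binom₂-periodic d N {k} k<M = begin
  binom₂ (M + N) k                         ≡⟨ cong (λ n → binom₂ (M + n) k) N≡ ⟩
  binom₂ (M + (M * (N / M) + N % M)) k     ≡⟨ cong (λ n → binom₂ n k) (+-assoc M _ (N % M)) ⟨
  binom₂ (M + M * (N / M) + N % M) k       ≡⟨ cong (λ n → binom₂ (n + N % M) k) (*-suc M (N / M)) ⟨
  binom₂ (M * suc (N / M) + N % M) k       ≡⟨ binom₂-low d (suc (N / M)) (m%n<n N M) k<M ⟩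
  binom₂ (N % M) k                         ≡⟨ binom₂-low d (N / M) (m%n<n N M) k<M ⟨
  binom₂ (M * (N / M) + N % M) k           ≡⟨ cong (λ n → binom₂ n k) N≡ ⟨
  binom₂ N k                               ∎
  where
  open ≡-Reasoning
  M = 2 ^ d
  instance
    M≢0 : NonZero M
    M≢0 = m^n≢0 2 d
  N≡ : N ≡ M * (N / M) + N % M
  N≡ = trans (m≡m%n+[m/n]*n N M) (trans (+-comm (N % M) _) (cong (_+ N % M) (*-comm (N / M) M)))

binom₂-+-+ : ∀ d {n k} → n < 2 ^ d → k < 2 ^ d → binom₂ (2 ^ d + n) (2 ^ d + k) ≡ binom₂ n k
binom₂-+-+ d {n} {k} n<M k<M =
  trans (cong₂ binom₂ (M+≡M*1+ n) (M+≡M*1+ k)) (binom₂-lucas d 1 1 n k n<M k<M)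
  where
  M+≡M*1+ : ∀ x → 2 ^ d + x ≡ 2 ^ d * 1 + x
  M+≡M*1+ x = cong (_+ x) (sym (*-identityʳ (2 ^ d)))

binom₂-low-bit : ∀ ℓ T {s b} → s < 2 ^ ℓ → b < ℓ → binom₂ (2 ^ ℓ * T + s) (2 ^ b) ≡ binom₂ s (2 ^ b)
binom₂-low-bit ℓ T s<2^ℓ b<ℓ = binom₂-low ℓ T s<2^ℓ (^-monoʳ-< 2 (s≤s (s≤s z≤n)) b<ℓ)

binom₂-high-bit : ∀ ℓ T {s} → s < 2 ^ ℓ → ∀ b → binom₂ (2 ^ ℓ * T + s) (2 ^ (ℓ + b)) ≡ binom₂ T (2 ^ b)
binom₂-high-bit ℓ T {s} s<2^ℓ b = begin
  binom₂ (2 ^ ℓ * T + s) (2 ^ (ℓ + b))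
    ≡⟨ cong (binom₂ (2 ^ ℓ * T + s)) (trans (^-distribˡ-+-* 2 ℓ b) (sym (+-identityʳ _))) ⟩
  binom₂ (2 ^ ℓ * T + s) (2 ^ ℓ * 2 ^ b + 0)
    ≡⟨ binom₂-lucas ℓ T (2 ^ b) s 0 s<2^ℓ (m^n>0 2 ℓ) ⟩
  binom₂ T (2 ^ b) ∧ binom₂ s 0
    ≡⟨ cong (binom₂ T (2 ^ b) ∧_) (binom₂-zeroʳ s) ⟩
  binom₂ T (2 ^ b) ∧ true
    ≡⟨ ∧-identityʳ _ ⟩
  binom₂ T (2 ^ b)
    ∎
  where open ≡-Reasoning

-- Either x + b < 2^d and the extra 2^d is a top bit on both sides, or the sum
-- carries past 2^d and both sides vanish.
binom₂-+pow-diagonal : ∀ d {x b} → x < 2 ^ d → b < 2 ^ d → binom₂ (x + (2 ^ d + b)) (2 ^ d + b) ≡ binom₂ (x + b) b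
binom₂-+pow-diagonal d {x} {b} x<M b<M = by-carry (halves d (+-<-2^suc d x<M b<M)) refl
  where
  M = 2 ^ d
  x+[M+b]≡ : x + (M + b) ≡ M + (x + b)
  x+[M+b]≡ = trans (sym (+-assoc x M b)) (trans (cong (_+ b) (+-comm x M)) (+-assoc M x b))
  by-carry : ∀ {n} → Halves M n → n ≡ x + b → binom₂ (x + (M + b)) (M + b) ≡ binom₂ (x + b) b
  by-carry (lower n<M) refl = trans (cong (λ n → binom₂ n (M + b)) x+[M+b]≡) (binom₂-+-+ d n<M b<M)
  by-carry (upper {y} y<M) M+y≡x+b = begin
    binom₂ (x + (M + b)) (M + b)   ≡⟨ cong₂ binom₂ x+[M+b]≡′ (cong (_+ b) (*-identityʳ M)) ⟨
    binom₂ (M * 2 + y) (M * 1 + b) ≡⟨ binom₂-lucas d 2 1 y b y<M b<M ⟩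
    false                          ≡⟨ binom₂-< y<b ⟨
    binom₂ y b                     ≡⟨ binom₂-periodic d y b<M ⟨
    binom₂ (M + y) b               ≡⟨ cong (λ n → binom₂ n b) M+y≡x+b ⟩
    binom₂ (x + b) b               ∎
    where
    open ≡-Reasoning
    y<b : y < b
    y<b = +-cancelˡ-< M y b (subst (_< M + b) (sym M+y≡x+b) (+-monoˡ-< b x<M))
    x+[M+b]≡′ : M * 2 + y ≡ x + (M + b)
    x+[M+b]≡′ = trans (solve 2 (λ M y → M :* con 2 :+ y := M :+ (M :+ y)) refl M y)
                      (trans (cong (M +_) M+y≡x+b) (sym x+[M+b]≡))

-- Column 2^d - 1 - b of M_d holds the parities of binom (x + b) b, the
-- form in which Pascal's rule acts on the row index x.
binom₂-complement : ∀ d {x b} → x < 2 ^ d → b < 2 ^ d → binom₂ (2 ^ d ∸ 1 ∸ b) x ≡ binom₂ (x + b) b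
binom₂-complement zero {zero} {zero} _ _ = refl
binom₂-complement zero {suc x} (s≤s ()) _
binom₂-complement zero {b = suc b} _ (s≤s ())
binom₂-complement (suc d) x<2M b<2M with halves d x<2M | halves d b<2M
... | lower {x} x<M | lower {b} b<M = begin
  binom₂ (2 ^ suc d ∸ 1 ∸ b) x      ≡⟨ cong (λ n → binom₂ n x) (complement-lower d b<M) ⟩
  binom₂ (M + (M ∸ 1 ∸ b)) x        ≡⟨ binom₂-periodic d (M ∸ 1 ∸ b) x<M ⟩
  binom₂ (M ∸ 1 ∸ b) x              ≡⟨ binom₂-complement d x<M b<M ⟩
  binom₂ (x + b) b                  ∎
  where
  open ≡-Reasoning
  M = 2 ^ d
... | upper {x} x<M | lower {b} b<M = begin
  binom₂ (2 ^ suc d ∸ 1 ∸ b) (M + x) ≡⟨ cong (λ n → binom₂ n (M + x)) (complement-lower d b<M) ⟩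
  binom₂ (M + (M ∸ 1 ∸ b)) (M + x)   ≡⟨ binom₂-+-+ d (2^∸1∸-< d b) x<M ⟩
  binom₂ (M ∸ 1 ∸ b) x               ≡⟨ binom₂-complement d x<M b<M ⟩
  binom₂ (x + b) b                   ≡⟨ binom₂-periodic d (x + b) b<M ⟨
  binom₂ (M + (x + b)) b             ≡⟨ cong (λ n → binom₂ n b) (+-assoc M x b) ⟨
  binom₂ (M + x + b) b               ∎
  where
  open ≡-Reasoning
  M = 2 ^ d
... | lower {x} x<M | upper {b} b<M = begin
  binom₂ (2 ^ suc d ∸ 1 ∸ (M + b)) x   ≡⟨ cong (λ n → binom₂ n x) (complement-upper d b) ⟩
  binom₂ (M ∸ 1 ∸ b) x                ≡⟨ binom₂-complement d x<M b<M ⟩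
  binom₂ (x + b) b                    ≡⟨ binom₂-+pow-diagonal d x<M b<M ⟨
  binom₂ (x + (M + b)) (M + b)        ∎
  where
  open ≡-Reasoning
  M = 2 ^ d
... | upper {x} x<M | upper {b} b<M = begin
  binom₂ (2 ^ suc d ∸ 1 ∸ (M + b)) (M + x)
    ≡⟨ binom₂-< (subst (_< M + x) (sym (complement-upper d b)) (<-≤-trans (2^∸1∸-< d b) (m≤m+n M x))) ⟩
  false
    ≡⟨ binom₂-< (+-monoˡ-< b x<M) ⟨
  binom₂ (x + b) (M + b)
    ≡⟨ binom₂-lucas (suc d) 1 0 (x + b) (M + b) (+-<-2^suc d x<M b<M) M+b<2M ⟨
  binom₂ (2 ^ suc d * 1 + (x + b)) (2 ^ suc d * 0 + (M + b))
    ≡⟨ cong₂ binom₂ (solve 3 (λ M x b → con 2 :* M :* con 1 :+ (x :+ b) := (M :+ x) :+ (M :+ b)) refl M x b)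
                    (cong (_+ (M + b)) (*-zeroʳ (2 ^ suc d))) ⟩
  binom₂ ((M + x) + (M + b)) (M + b)         ∎
  where
  open ≡-Reasoning
  M = 2 ^ d
  M+b<2M : M + b < 2 ^ suc d
  M+b<2M = subst (M + b <_) (cong (M +_) (sym (+-identityʳ M))) (+-monoʳ-< M b<M)

nth : {A : Set} → A → List A → ℕ → A
nth d []       i       = d
nth d (x ∷ xs) zero    = x
nth d (x ∷ xs) (suc i) = nth d xs i

infixl 9 _‼_
_‼_ : List Bool → ℕ → Bool
_‼_ = nth false

‼-lookup : ∀ {n} (v : Vec Bool n) i → toList v ‼ toℕ i ≡ lookup v i
‼-lookup (x ∷ v) Fin.zero    = refl
‼-lookup (x ∷ v) (Fin.suc i) = ‼-lookup v i

‼-tabulate : ∀ {n} (f : Fin n → Bool) {i} (i<n : i < n) → toList (tabulate f) ‼ i ≡ f (fromℕ< i<n)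
‼-tabulate f {i} i<n =
  trans (cong (toList (tabulate f) ‼_) (sym (toℕ-fromℕ< i<n)))
        (trans (‼-lookup (tabulate f) (fromℕ< i<n)) (lookup∘tabulate f _))

nth-++ˡ : ∀ {A : Set} (d : A) xs ys {i} → i < length xs → nth d (xs ++ ys) i ≡ nth d xs i
nth-++ˡ d (x ∷ xs) ys {zero}  _         = refl
nth-++ˡ d (x ∷ xs) ys {suc i} (s<s i<n) = nth-++ˡ d xs ys i<n

nth-++ʳ : ∀ {A : Set} (d : A) xs ys i → nth d (xs ++ ys) (length xs + i) ≡ nth d ys i
nth-++ʳ d []       ys i = refl
nth-++ʳ d (x ∷ xs) ys i = nth-++ʳ d xs ys i

nth-map : ∀ {A B : Set} {d : A} {d′ : B} (f : A → B) xs {i} → i < length xs → nth d′ (map f xs) i ≡ f (nth d xs i)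
nth-map f (x ∷ xs) {zero}  _         = refl
nth-map f (x ∷ xs) {suc i} (s<s i<n) = nth-map f xs i<n

nth-take : ∀ {A : Set} (d : A) n xs {i} → i < n → nth d (take n xs) i ≡ nth d xs i
nth-take d (suc n) []       _         = refl
nth-take d (suc n) (x ∷ xs) {zero}  _ = refl
nth-take d (suc n) (x ∷ xs) {suc i} (s<s i<n) = nth-take d n xs i<n

nth-drop : ∀ {A : Set} (d : A) n xs i → nth d (drop n xs) i ≡ nth d xs (n + i)
nth-drop d zero    xs       i = refl
nth-drop d (suc n) []       i = refl
nth-drop d (suc n) (x ∷ xs) i = nth-drop d n xs i

module _ {A : Set} (f : A → List Bool) {m} (|f| : ∀ x → length (f x) ≡ m) where

  length-concatMap : ∀ xs → length (List.concatMap f xs) ≡ length xs * m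
  length-concatMap []       = refl
  length-concatMap (x ∷ xs) = trans (length-++ (f x)) (cong₂ _+_ (|f| x) (length-concatMap xs))

  ‼-concatMap : ∀ (d : A) xs {S i} → S < length xs → i < m → List.concatMap f xs ‼ (S * m + i) ≡ f (nth d xs S) ‼ i
  ‼-concatMap d (x ∷ xs) {zero}  {i} _ i<m = nth-++ˡ false (f x) _ (subst (i <_) (sym (|f| x)) i<m)
  ‼-concatMap d (x ∷ xs) {suc S} {i} (s<s S<n) i<m = begin
    (f x ++ List.concatMap f xs) ‼ (m + S * m + i)
      ≡⟨ cong (λ k → (f x ++ List.concatMap f xs) ‼ k) (trans (+-assoc m (S * m) i) (cong (_+ (S * m + i)) (sym (|f| x)))) ⟩
    (f x ++ List.concatMap f xs) ‼ (length (f x) + (S * m + i))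
      ≡⟨ nth-++ʳ false (f x) _ (S * m + i) ⟩
    List.concatMap f xs ‼ (S * m + i)
      ≡⟨ ‼-concatMap d xs S<n i<m ⟩
    f (nth d xs S) ‼ i
      ∎
    where open ≡-Reasoning

‼-zipWith : ∀ {n} (f : Bool → Bool → Bool) (x y : Vec Bool n) {j} → j < n →
  toList (Vec.zipWith f x y) ‼ j ≡ f (toList x ‼ j) (toList y ‼ j)
‼-zipWith f (a ∷ x) (b ∷ y) {zero}  _         = refl
‼-zipWith f (a ∷ x) (b ∷ y) {suc j} (s<s j<n) = ‼-zipWith f x y j<n

‼-∷ʳ-last : ∀ {n} (v : Vec Bool n) y → toList (v ∷ʳ y) ‼ n ≡ y
‼-∷ʳ-last []      y = refl
‼-∷ʳ-last (x ∷ v) y = ‼-∷ʳ-last v y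

‼-∷ʳ-init : ∀ {n} (v : Vec Bool n) y {i} → i < n → toList (v ∷ʳ y) ‼ i ≡ toList v ‼ i
‼-∷ʳ-init (x ∷ v) y {zero}  _         = refl
‼-∷ʳ-init (x ∷ v) y {suc i} (s≤s i<n) = ‼-∷ʳ-init v y i<n

‼-σ-zero : ∀ {n} (v : Vec Bool (suc n)) → toList (σ v) ‼ 0 ≡ toList v ‼ n
‼-σ-zero {n} v with initLast v
... | u , y , v≡u∷ʳy = trans (sym (‼-∷ʳ-last u y)) (cong (λ w → toList w ‼ n) (sym v≡u∷ʳy))

‼-σ-suc : ∀ {n} (v : Vec Bool (suc n)) {i} → i < n → toList (σ v) ‼ suc i ≡ toList v ‼ i
‼-σ-suc v {i} i<n with initLast v
... | u , y , v≡u∷ʳy = trans (sym (‼-∷ʳ-init u y i<n)) (cong (λ w → toList w ‼ i) (sym v≡u∷ʳy))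

‼-σ^-≥ : ∀ {n} (v : Vec Bool n) k {i} → k ≤ i → i < n → toList (σ^ k v) ‼ i ≡ toList v ‼ (i ∸ k)
‼-σ^-≥ v zero _ _ = refl
‼-σ^-≥ {suc n} v (suc k) {suc i} (s≤s k≤i) (s≤s i<n) =
  trans (‼-σ-suc (σ^ k v) i<n) (‼-σ^-≥ v k k≤i (m≤n⇒m≤1+n i<n))

‼-σ^-< : ∀ {n} (v : Vec Bool n) k {i} → i < k → k ≤ n → toList (σ^ k v) ‼ i ≡ toList v ‼ (n + i ∸ k)
‼-σ^-< {suc n} v (suc k) {zero} _ (s≤s k≤n) =
  trans (‼-σ-zero (σ^ k v)) (trans (‼-σ^-≥ v k k≤n (n<1+n n)) (cong (λ m → toList v ‼ (m ∸ k)) (sym (+-identityʳ n))))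
‼-σ^-< {suc n} v (suc k) {suc i} (s≤s i<k) (s≤s k≤n) =
  trans (‼-σ-suc (σ^ k v) (<-≤-trans i<k k≤n))
        (trans (‼-σ^-< v k i<k (m≤n⇒m≤1+n k≤n)) (cong (λ m → toList v ‼ (m ∸ k)) (sym (+-suc n i))))

⨁ : ℕ → (ℕ → Bool) → Bool
⨁ zero    f = false
⨁ (suc n) f = f 0 xor ⨁ n (λ j → f (suc j))

syntax ⨁ n (λ j → e) = ⨁[ j < n ] e

⨁-cong : ∀ n {f g : ℕ → Bool} → (∀ j → j < n → f j ≡ g j) → ⨁ n f ≡ ⨁ n g
⨁-cong zero    f≡g = refl
⨁-cong (suc n) f≡g = cong₂ _xor_ (f≡g 0 z<s) (⨁-cong n (λ j j<n → f≡g (suc j) (s<s j<n)))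

⨁-+ : ∀ a b (f : ℕ → Bool) → ⨁ (a + b) f ≡ ⨁ a f xor ⨁[ j < b ] f (a + j)
⨁-+ zero    b f = refl
⨁-+ (suc a) b f = trans (cong (f 0 xor_) (⨁-+ a b (λ j → f (suc j)))) (sym (xor-assoc (f 0) _ _))

⨁-xor : ∀ n (f g : ℕ → Bool) → ⨁[ j < n ] (f j xor g j) ≡ ⨁ n f xor ⨁ n g
⨁-xor zero    f g = refl
⨁-xor (suc n) f g = trans (cong ((f 0 xor g 0) xor_) (⨁-xor n _ _)) (xor-interchange (f 0) (g 0) _ _)

⨁-last : ∀ n (f : ℕ → Bool) → ⨁ (suc n) f ≡ ⨁ n f xor f n
⨁-last zero    f = xor-comm (f 0) false
⨁-last (suc n) f = trans (cong (f 0 xor_) (⨁-last n (λ j → f (suc j)))) (sym (xor-assoc (f 0) _ _))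

⨁-reverse : ∀ n (f : ℕ → Bool) → ⨁ n f ≡ ⨁[ j < n ] f (n ∸ 1 ∸ j)
⨁-reverse zero    f = refl
⨁-reverse (suc n) f = begin
  ⨁ (suc n) f                          ≡⟨ ⨁-last n f ⟩
  ⨁ n f xor f n                        ≡⟨ cong (_xor f n) (⨁-reverse n f) ⟩
  (⨁[ j < n ] f (n ∸ 1 ∸ j)) xor f n   ≡⟨ xor-comm _ (f n) ⟩
  f n xor ⨁[ j < n ] f (n ∸ 1 ∸ j)     ≡⟨ cong (f n xor_) (⨁-cong n (λ j _ → cong f (∸-+-assoc n 1 j))) ⟩
  ⨁[ j < suc n ] f (suc n ∸ 1 ∸ j)     ∎
  where open ≡-Reasoning

xorSum-⨁ : ∀ {n} (v : Vec Bool n) → xorSum v ≡ ⨁[ j < n ] (toList v ‼ j)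
xorSum-⨁ []      = refl
xorSum-⨁ (x ∷ v) = cong (x xor_) (xorSum-⨁ v)

∑ : ℕ → (ℕ → ℕ) → ℕ
∑ zero    f = 0
∑ (suc n) f = f 0 + ∑ n (f ∘ suc)

syntax ∑ n (λ i → e) = ∑[ i < n ] e

∑-cong : ∀ n {f g : ℕ → ℕ} → (∀ i → i < n → f i ≡ g i) → ∑ n f ≡ ∑ n g
∑-cong zero    f≡g = refl
∑-cong (suc n) f≡g = cong₂ _+_ (f≡g 0 z<s) (∑-cong n (λ i i<n → f≡g (suc i) (s<s i<n)))

∑-+ : ∀ a b (f : ℕ → ℕ) → ∑ (a + b) f ≡ ∑ a f + ∑[ i < b ] f (a + i)
∑-+ zero    b f = refl
∑-+ (suc a) b f = trans (cong (f 0 +_) (∑-+ a b (f ∘ suc))) (sym (+-assoc (f 0) _ _))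

∑-zero : ∀ n → ∑[ i < n ] 0 ≡ 0
∑-zero zero    = refl
∑-zero (suc n) = ∑-zero n

∑-one : ∀ n → ∑[ i < n ] 1 ≡ n
∑-one zero    = refl
∑-one (suc n) = cong suc (∑-one n)

∑-distrib : ∀ n (f g : ℕ → ℕ) → ∑[ i < n ] (f i + g i) ≡ ∑ n f + ∑ n g
∑-distrib zero    f g = refl
∑-distrib (suc n) f g = trans (cong (f 0 + g 0 +_) (∑-distrib n (f ∘ suc) (g ∘ suc))) (+-interchange (f 0) (g 0) _ _)

∑-blocks : ∀ m N (f : ℕ → ℕ) → ∑ (N * m) f ≡ ∑[ s < N ] ∑[ r < m ] f (s * m + r)
∑-blocks m zero    f = refl
∑-blocks m (suc N) f = trans (∑-+ m (N * m) f) (cong (∑ m f +_) (trans (∑-blocks m N (λ i → f (m + i)))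
  (∑-cong N (λ s _ → ∑-cong m (λ r _ → cong f (sym (+-assoc m (s * m) r)))))))

∑-swap : ∀ m N (f : ℕ → ℕ → ℕ) → ∑[ s < N ] ∑[ r < m ] f s r ≡ ∑[ r < m ] ∑[ s < N ] f s r
∑-swap m zero    f = sym (∑-zero m)
∑-swap m (suc N) f = trans (cong (∑[ r < m ] f 0 r +_) (∑-swap m N (f ∘ suc)))
                           (sym (∑-distrib m (f 0) (λ r → ∑[ s < N ] f (suc s) r)))

𝟙 : ∀ {p} {P : Set p} → Dec P → ℕ
𝟙 P? = if does P? then 1 else 0

∑-𝟙-none : ∀ {p} {P : ℕ → Set p} (P? : Decidable P) N → (∀ s → s < N → ¬ P s) → ∑[ s < N ] 𝟙 (P? s) ≡ 0
∑-𝟙-none P? zero    _    = refl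
∑-𝟙-none P? (suc N) none with P? 0
... | yes P0 = ⊥-elim (none 0 z<s P0)
... | no  _  = ∑-𝟙-none (P? ∘ suc) N (λ s s<N → none (suc s) (s<s s<N))

∑-𝟙-unique : ∀ {p} {P : ℕ → Set p} (P? : Decidable P) N {s₀} → s₀ < N → P s₀ →
  (∀ s → s < N → P s → s ≡ s₀) → ∑[ s < N ] 𝟙 (P? s) ≡ 1
∑-𝟙-unique P? (suc N) {zero} _ P0 unique with P? 0
... | no ¬P0 = ⊥-elim (¬P0 P0)
... | yes _  = cong suc (∑-𝟙-none (P? ∘ suc) N (λ s s<N Ps → 1+n≢0 (unique (suc s) (s<s s<N) Ps)))
∑-𝟙-unique P? (suc N) {suc s₀} (s<s s₀<N) Ps₀ unique with P? 0
... | yes P0 = ⊥-elim (0≢1+n (unique 0 z<s P0))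
... | no  _  = ∑-𝟙-unique (P? ∘ suc) N s₀<N Ps₀ (λ s s<N Ps → suc-injective (unique (suc s) (s<s s<N) Ps))

-- The matrices M_d

Mentry-binom₂ : ∀ d {x y} → x < 2 ^ d → y < 2 ^ d → Mentry d x y ≡ binom₂ y x
Mentry-binom₂ zero {zero} {zero} _ _ = refl
Mentry-binom₂ zero {suc x} (s≤s ()) _
Mentry-binom₂ zero {y = suc y} _ (s≤s ())
Mentry-binom₂ (suc d) x<2M y<2M with halves d x<2M | halves d y<2M
... | lower {x} x<M | lower {y} y<M
  rewrite <ᵇ-true x<M | <ᵇ-true y<M = Mentry-binom₂ d x<M y<M
... | lower {x} x<M | upper {y} y<M
  rewrite <ᵇ-true x<M | <ᵇ-false (m≤m+n (2 ^ d) y) | m+n∸m≡n (2 ^ d) y =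
  trans (Mentry-binom₂ d x<M y<M) (sym (binom₂-periodic d y x<M))
... | upper {x} x<M | lower {y} y<M
  rewrite <ᵇ-false (m≤m+n (2 ^ d) x) | <ᵇ-true y<M =
  sym (binom₂-< (<-≤-trans y<M (m≤m+n (2 ^ d) x)))
... | upper {x} x<M | upper {y} y<M
  rewrite <ᵇ-false (m≤m+n (2 ^ d) x) | <ᵇ-false (m≤m+n (2 ^ d) y) | m+n∸m≡n (2 ^ d) x | m+n∸m≡n (2 ^ d) y =
  trans (Mentry-binom₂ d x<M y<M) (sym (binom₂-+-+ d y<M x<M))

‼-column-complement : ∀ d (j : Fin (2 ^ d)) {b x} → toℕ j ≡ 2 ^ d ∸ 1 ∸ b → b < 2 ^ d → x < 2 ^ d →
  toList (column d j) ‼ x ≡ binom₂ (x + b) b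
‼-column-complement d j {b} {x} j≡ b<M x<M = begin
  toList (column d j) ‼ x           ≡⟨ ‼-tabulate _ x<M ⟩
  Mentry d (toℕ (fromℕ< x<M)) (toℕ j) ≡⟨ cong₂ (Mentry d) (toℕ-fromℕ< x<M) j≡ ⟩
  Mentry d x (2 ^ d ∸ 1 ∸ b)        ≡⟨ Mentry-binom₂ d x<M (2^∸1∸-< d b) ⟩
  binom₂ (2 ^ d ∸ 1 ∸ b) x          ≡⟨ binom₂-complement d x<M b<M ⟩
  binom₂ (x + b) b                  ∎
  where open ≡-Reasoning

-- Rotating the column down by n ≤ b shifts the Pascal pattern binom (x + b) b
-- by n rows, cyclically; the wrap-around is invisible because binom (x + b) b
-- has period 2^d in x.
‼-σ^-column : ∀ d (j : Fin (2 ^ d)) {b n i} → toℕ j ≡ 2 ^ d ∸ 1 ∸ b → b < 2 ^ d → n ≤ b → i < 2 ^ d →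
  toList (σ^ n (column d j)) ‼ i ≡ binom₂ (i + (b ∸ n)) b
‼-σ^-column d j {b} {n} {i} j≡ b<M n≤b i<M with n ≤? i
... | yes n≤i = begin
  toList (σ^ n (column d j)) ‼ i    ≡⟨ ‼-σ^-≥ (column d j) n n≤i i<M ⟩
  toList (column d j) ‼ (i ∸ n)     ≡⟨ ‼-column-complement d j j≡ b<M (≤-<-trans (m∸n≤m i n) i<M) ⟩
  binom₂ (i ∸ n + b) b              ≡⟨ cong (λ m → binom₂ m b) i∸n+b≡ ⟩
  binom₂ (i + (b ∸ n)) b            ∎
  where
  open ≡-Reasoning
  i∸n+b≡ : i ∸ n + b ≡ i + (b ∸ n)
  i∸n+b≡ = trans (sym (+-∸-comm b n≤i)) (+-∸-assoc i n≤b)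
... | no n≰i = begin
  toList (σ^ n (column d j)) ‼ i         ≡⟨ ‼-σ^-< (column d j) n i<n n≤M ⟩
  toList (column d j) ‼ (M + i ∸ n)      ≡⟨ ‼-column-complement d j j≡ b<M M+i∸n<M ⟩
  binom₂ (M + i ∸ n + b) b               ≡⟨ cong (λ m → binom₂ m b) M+i∸n+b≡ ⟩
  binom₂ (M + (i + (b ∸ n))) b           ≡⟨ binom₂-periodic d (i + (b ∸ n)) b<M ⟩
  binom₂ (i + (b ∸ n)) b                 ∎
  where
  open ≡-Reasoning
  M = 2 ^ d
  i<n : i < n
  i<n = ≰⇒> n≰i
  n≤M : n ≤ M
  n≤M = ≤-trans n≤b (<⇒≤ b<M)
  M+i∸n<M : M + i ∸ n < M
  M+i∸n<M = subst (_< M) (sym (+-∸-comm i n≤M))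
              (subst (M ∸ n + i <_) (m∸n+n≡m n≤M) (+-monoʳ-< (M ∸ n) i<n))
  M+i∸n+b≡ : M + i ∸ n + b ≡ M + (i + (b ∸ n))
  M+i∸n+b≡ = begin
    M + i ∸ n + b
      ≡⟨ cong (_+ b) (+-∸-comm i n≤M) ⟩
    M ∸ n + i + b
      ≡⟨ cong (M ∸ n + i +_) (m+[n∸m]≡n n≤b) ⟨
    M ∸ n + i + (n + (b ∸ n))
      ≡⟨ solve 4 (λ X i n c → X :+ i :+ (n :+ c) := X :+ n :+ (i :+ c)) refl (M ∸ n) i n (b ∸ n) ⟩
    M ∸ n + n + (i + (b ∸ n))
      ≡⟨ cong (_+ (i + (b ∸ n))) (m∸n+n≡m n≤M) ⟩
    M + (i + (b ∸ n))
      ∎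

‼-mulCols : ∀ {n} (cols : Fin n → Vec Bool n) (x : Vec Bool n) {i} → i < n → (a : ℕ → Bool) →
  (∀ {j} (j<n : j < n) → toList (cols (fromℕ< j<n)) ‼ i ≡ a j) →
  toList (mulCols cols x) ‼ i ≡ ⨁[ j < n ] (a j ∧ toList x ‼ j)
‼-mulCols {n} cols x {i} i<n a col≡ = begin
  toList (mulCols cols x) ‼ i
    ≡⟨ ‼-tabulate _ i<n ⟩
  xorSum row
    ≡⟨ xorSum-⨁ row ⟩
  ⨁[ j < n ] (toList row ‼ j)
    ≡⟨ ⨁-cong n (λ j j<n → trans (‼-tabulate _ j<n) (cong₂ _∧_ (entry j<n) (‼-lookup′ j<n))) ⟩
  ⨁[ j < n ] (a j ∧ toList x ‼ j)
    ∎
  where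
  open ≡-Reasoning
  row = tabulate (λ j → lookup (cols j) (fromℕ< i<n) ∧ lookup x j)
  entry : ∀ {j} (j<n : j < n) → lookup (cols (fromℕ< j<n)) (fromℕ< i<n) ≡ a j
  entry j<n = trans (sym (‼-lookup (cols (fromℕ< j<n)) (fromℕ< i<n)))
                    (trans (cong (toList (cols (fromℕ< j<n)) ‼_) (toℕ-fromℕ< i<n)) (col≡ j<n))
  ‼-lookup′ : ∀ {j} (j<n : j < n) → lookup x (fromℕ< j<n) ≡ toList x ‼ j
  ‼-lookup′ j<n = trans (sym (‼-lookup x (fromℕ< j<n))) (cong (toList x ‼_) (toℕ-fromℕ< j<n))

-- Pascal sums

pascalSum : (ℕ → ℕ) → ℕ → List Bool → ℕ → Bool
pascalSum τ e []      i = false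
pascalSum τ e (x ∷ s) i = (x ∧ binom₂ (i + τ 0) e) xor pascalSum (τ ∘ suc) (suc e) s i

pascalSum-pascal : ∀ τ e s i → pascalSum τ (suc e) s (suc i) ≡ pascalSum τ (suc e) s i xor pascalSum τ e s i
pascalSum-pascal τ e []      i = refl
pascalSum-pascal τ e (x ∷ s) i = begin
  (x ∧ binom₂ (suc i + τ 0) (suc e)) xor pascalSum (τ ∘ suc) (suc (suc e)) s (suc i)
    ≡⟨ cong₂ _xor_ (∧-distribˡ-xor x (binom₂ (i + τ 0) e) _) (pascalSum-pascal (τ ∘ suc) (suc e) s i) ⟩
  ((x ∧ binom₂ (i + τ 0) e) xor (x ∧ binom₂ (i + τ 0) (suc e))) xor (Q₂ xor Q₁)
    ≡⟨ cong (_xor (Q₂ xor Q₁)) (xor-comm (x ∧ binom₂ (i + τ 0) e) _) ⟩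
  ((x ∧ binom₂ (i + τ 0) (suc e)) xor (x ∧ binom₂ (i + τ 0) e)) xor (Q₂ xor Q₁)
    ≡⟨ xor-interchange (x ∧ binom₂ (i + τ 0) (suc e)) _ Q₂ Q₁ ⟩
  ((x ∧ binom₂ (i + τ 0) (suc e)) xor Q₂) xor ((x ∧ binom₂ (i + τ 0) e) xor Q₁)
    ∎
  where
  open ≡-Reasoning
  Q₂ = pascalSum (τ ∘ suc) (suc (suc e)) s i
  Q₁ = pascalSum (τ ∘ suc) (suc e) s i

pascalSum-shift : ∀ τ τ′ e s i j → (∀ b → b < length s → i + τ b ≡ j + τ′ b) → pascalSum τ e s i ≡ pascalSum τ′ e s j
pascalSum-shift τ τ′ e []      i j _    = refl
pascalSum-shift τ τ′ e (x ∷ s) i j i+τ≡ =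
  cong₂ _xor_ (cong (λ n → x ∧ binom₂ n e) (i+τ≡ 0 z<s))
              (pascalSum-shift (τ ∘ suc) (τ′ ∘ suc) (suc e) s i j (λ b b<s → i+τ≡ (suc b) (s<s b<s)))

pascalSum-vanish : ∀ τ e s i → (∀ b → b < length s → i + τ b < b + e) → pascalSum τ e s i ≡ false
pascalSum-vanish τ e []      i _ = refl
pascalSum-vanish τ e (x ∷ s) i small =
  cong₂ _xor_ (trans (cong (x ∧_) (binom₂-< (small 0 z<s))) (∧-zeroʳ x))
              (pascalSum-vanish (τ ∘ suc) (suc e) s i
                 (λ b b<s → subst (i + τ (suc b) <_) (sym (+-suc b e)) (small (suc b) (s<s b<s))))

pascalSum-periodic : ∀ d τ e s i → (∀ b → b < length s → b + e < 2 ^ d) →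
  pascalSum τ e s (2 ^ d + i) ≡ pascalSum τ e s i
pascalSum-periodic d τ e []      i _ = refl
pascalSum-periodic d τ e (x ∷ s) i below =
  cong₂ _xor_ (cong (x ∧_) (trans (cong (λ n → binom₂ n e) (+-assoc (2 ^ d) i (τ 0)))
                                   (binom₂-periodic d (i + τ 0) (below 0 z<s))))
              (pascalSum-periodic d (τ ∘ suc) (suc e) s i
                 (λ b b<s → subst (_< 2 ^ d) (sym (+-suc b e)) (below (suc b) (s<s b<s))))

pascalSum-head : ∀ τ x s i → pascalSum τ 0 (x ∷ s) i ≡ x xor pascalSum (τ ∘ suc) 1 s i
pascalSum-head τ x s i = cong (_xor pascalSum (τ ∘ suc) 1 s i) (trans (cong (x ∧_) (binom₂-zeroʳ (i + τ 0))) (∧-identityʳ x))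

pascalSum-difference : ∀ τ s i → pascalSum τ 0 s i ≡ pascalSum τ 1 s (suc i) xor pascalSum τ 1 s i
pascalSum-difference τ s i = begin
  P₀                 ≡⟨ cong (_xor P₀) (xor-same P₁) ⟨
  (P₁ xor P₁) xor P₀  ≡⟨ xor-assoc P₁ P₁ P₀ ⟩
  P₁ xor (P₁ xor P₀)  ≡⟨ xor-comm P₁ _ ⟩
  (P₁ xor P₀) xor P₁  ≡⟨ cong (_xor P₁) (pascalSum-pascal τ 0 s i) ⟨
  pascalSum τ 1 s (suc i) xor P₁ ∎
  where
  open ≡-Reasoning
  P₀ = pascalSum τ 0 s i
  P₁ = pascalSum τ 1 s i

xor-xor-cancel : ∀ x p q → (x xor p) xor (x xor q) ≡ p xor q
xor-xor-cancel x p q = trans (xor-interchange x p x q) (cong (_xor (p xor q)) (xor-same x))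

pascalSum-tail-difference : ∀ τ x s i →
  pascalSum (τ ∘ suc) 0 s i ≡ pascalSum τ 0 (x ∷ s) (suc i) xor pascalSum τ 0 (x ∷ s) i
pascalSum-tail-difference τ x s i = begin
  pascalSum (τ ∘ suc) 0 s i
    ≡⟨ pascalSum-difference (τ ∘ suc) s i ⟩
  Q (suc i) xor Q i
    ≡⟨ xor-xor-cancel x (Q (suc i)) (Q i) ⟨
  (x xor Q (suc i)) xor (x xor Q i)
    ≡⟨ cong₂ _xor_ (pascalSum-head τ x s (suc i)) (pascalSum-head τ x s i) ⟨
  pascalSum τ 0 (x ∷ s) (suc i) xor pascalSum τ 0 (x ∷ s) i
    ∎
  where
  open ≡-Reasoning
  Q = pascalSum (τ ∘ suc) 1 s

pascalSum-⨁ : ∀ τ e s i → pascalSum τ e s i ≡ ⨁[ b < length s ] (s ‼ b ∧ binom₂ (i + τ b) (b + e))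
pascalSum-⨁ τ e []      i = refl
pascalSum-⨁ τ e (x ∷ s) i = cong ((x ∧ binom₂ (i + τ 0) e) xor_) (trans (pascalSum-⨁ (τ ∘ suc) (suc e) s i)
  (⨁-cong (length s) (λ b _ → cong (λ k → s ‼ b ∧ binom₂ (i + τ (suc b)) k) (+-suc b e))))

record AgreeOn (f g : ℕ → Bool) (lo n : ℕ) : Set where
  constructor agreeOn
  field agree-at : ∀ j → j < n → f (lo + j) ≡ g (lo + j)
open AgreeOn

module _ {f g : ℕ → Bool} {lo : ℕ} where

  agreeOn-first : ∀ {n} → AgreeOn f g lo (suc n) → f lo ≡ g lo
  agreeOn-first agree = subst (λ i → f i ≡ g i) (+-identityʳ lo) (agree-at agree 0 z<s)

  agreeOn-last : ∀ {n} → AgreeOn f g lo (suc n) → f (lo + n) ≡ g (lo + n)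
  agreeOn-last {n} agree = agree-at agree n ≤-refl

  agreeOn-init : ∀ {n} → AgreeOn f g lo (suc n) → AgreeOn f g lo n
  agreeOn-init agree = agreeOn λ j j<n → agree-at agree j (m≤n⇒m≤1+n j<n)

  agreeOn-tail : ∀ {n} → AgreeOn f g lo (suc n) → AgreeOn f g (suc lo) n
  agreeOn-tail agree = agreeOn λ j j<n → subst (λ i → f i ≡ g i) (+-suc lo j) (agree-at agree (suc j) (s<s j<n))

  agreeOn-cons : ∀ {n} → f lo ≡ g lo → AgreeOn f g (suc lo) n → AgreeOn f g lo (suc n)
  agreeOn-cons first rest = agreeOn λ where
    zero    _         → subst (λ i → f i ≡ g i) (sym (+-identityʳ lo)) first
    (suc j) (s<s j<n) → subst (λ i → f i ≡ g i) (sym (+-suc lo j)) (agree-at rest j j<n)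

  agreeOn-snoc : ∀ {n} → AgreeOn f g lo n → f (lo + n) ≡ g (lo + n) → AgreeOn f g lo (suc n)
  agreeOn-snoc {n} agree last = agreeOn λ j j<1+n → case j (m≤n⇒m<n∨m≡n (s≤s⁻¹ j<1+n))
    where
    case : ∀ j → j < n ⊎ j ≡ n → f (lo + j) ≡ g (lo + j)
    case j (inj₁ j<n)  = agree-at agree j j<n
    case j (inj₂ refl) = last

  agreeOn-xorˡ : ∀ {n} x → AgreeOn (λ i → x xor f i) (λ i → x xor g i) lo n → AgreeOn f g lo n
  agreeOn-xorˡ x agree = agreeOn λ j j<n → xor-cancelˡ x _ _ (agree-at agree j j<n)

  agreeOn-difference : ∀ {n} → AgreeOn f g lo (suc n) →
    AgreeOn (λ i → f (suc i) xor f i) (λ i → g (suc i) xor g i) lo n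
  agreeOn-difference agree = agreeOn λ j j<n →
    cong₂ _xor_ (agree-at (agreeOn-tail agree) j j<n) (agree-at (agreeOn-init agree) j j<n)

agreeOn-suc : ∀ {f g lo n} → AgreeOn (f ∘ suc) (g ∘ suc) lo n → AgreeOn f g (suc lo) n
agreeOn-suc agree = agreeOn (agree-at agree)

agreeOn-resp : ∀ {f f′ g g′ lo n} → (∀ i → f i ≡ f′ i) → (∀ i → g i ≡ g′ i) →
  AgreeOn f g lo n → AgreeOn f′ g′ lo n
agreeOn-resp f≡ g≡ agree = agreeOn λ j j<n → trans (sym (f≡ _)) (trans (agree-at agree j j<n) (g≡ _))

agreeOn-pascalSum-tail : ∀ τ x y s t {lo n} →
  AgreeOn (pascalSum τ 0 (x ∷ s)) (pascalSum τ 0 (y ∷ t)) lo (suc n) →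
  AgreeOn (pascalSum (τ ∘ suc) 0 s) (pascalSum (τ ∘ suc) 0 t) lo n
agreeOn-pascalSum-tail τ x y s t agree =
  agreeOn-resp (λ i → sym (pascalSum-tail-difference τ x s i)) (λ i → sym (pascalSum-tail-difference τ y t i))
               (agreeOn-difference agree)

pascalSum-window-injective : ∀ τ s t → length s ≡ length t → ∀ lo →
  AgreeOn (pascalSum τ 0 s) (pascalSum τ 0 t) lo (length s) → s ≡ t
pascalSum-window-injective τ []      []      _     lo _     = refl
pascalSum-window-injective τ (x ∷ s) (y ∷ t) |s|≡|t| lo agree = cong₂ _∷_ x≡y s≡t
  where
  s≡t : s ≡ t
  s≡t = pascalSum-window-injective (τ ∘ suc) s t (suc-injective |s|≡|t|) lo (agreeOn-pascalSum-tail τ x y s t agree)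
  x≡y : x ≡ y
  x≡y = xor-cancelʳ (pascalSum (τ ∘ suc) 1 s lo) x y
          (trans (sym (pascalSum-head τ x s lo))
                 (trans (agreeOn-first agree) (trans (pascalSum-head τ y t lo) (cong (λ u → y xor pascalSum (τ ∘ suc) 1 u lo) (sym s≡t)))))

agreeOn-pascalSum-head : ∀ τ x s t {lo n} →
  AgreeOn (pascalSum τ 0 (x ∷ s)) (pascalSum τ 0 (x ∷ t)) lo n →
  AgreeOn (pascalSum (τ ∘ suc) 1 s) (pascalSum (τ ∘ suc) 1 t) lo n
agreeOn-pascalSum-head τ x s t agree =
  agreeOn-xorˡ x (agreeOn-resp (pascalSum-head τ x s) (pascalSum-head τ x t) agree)

pascalSum-head-alone : ∀ τ x s i → pascalSum (τ ∘ suc) 1 s i ≡ false → pascalSum τ 0 (x ∷ s) i ≡ x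
pascalSum-head-alone τ x s i rest≡0 = trans (pascalSum-head τ x s i) (trans (cong (x xor_) rest≡0) (xor-identityʳ x))

agreeOn-pascalSum-difference : ∀ τ s t {lo n} →
  AgreeOn (pascalSum τ 1 s) (pascalSum τ 1 t) lo (suc n) → AgreeOn (pascalSum τ 0 s) (pascalSum τ 0 t) lo n
agreeOn-pascalSum-difference τ s t agree =
  agreeOn-resp (λ i → sym (pascalSum-difference τ s i)) (λ i → sym (pascalSum-difference τ t i)) (agreeOn-difference agree)

-- Staircases and carries

Staircase : ℕ → (ℕ → ℕ) → Set
Staircase ℓ τ = τ 0 ≡ 0 × (∀ b → suc b < ℓ → τ (suc b) ≡ τ b ⊎ τ (suc b) ≡ suc (τ b))

module _ {ℓ τ} (stair : Staircase ℓ τ) where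

  staircase-≤ : ∀ {b} → b < ℓ → τ b ≤ b
  staircase-≤ {zero}  _       = ≤-reflexive (proj₁ stair)
  staircase-≤ {suc b} 1+b<ℓ with proj₂ stair b 1+b<ℓ
  ... | inj₁ stay  = subst (_≤ suc b) (sym stay) (m≤n⇒m≤1+n (staircase-≤ (<-trans (n<1+n b) 1+b<ℓ)))
  ... | inj₂ climb = subst (_≤ suc b) (sym climb) (s≤s (staircase-≤ (<-trans (n<1+n b) 1+b<ℓ)))

  staircase-≥₁ : ∀ {b} → suc b < ℓ → τ 1 ≤ τ (suc b)
  staircase-≥₁ {zero}  _       = ≤-refl
  staircase-≥₁ {suc b} 2+b<ℓ with proj₂ stair (suc b) 2+b<ℓ
  ... | inj₁ stay  = subst (τ 1 ≤_) (sym stay) (staircase-≥₁ (<-trans (n<1+n _) 2+b<ℓ))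
  ... | inj₂ climb = subst (τ 1 ≤_) (sym climb) (m≤n⇒m≤1+n (staircase-≥₁ (<-trans (n<1+n _) 2+b<ℓ)))

  pascalSum-staircase-zero : ∀ u → length u ≡ ℓ → pascalSum τ 1 u 0 ≡ false
  pascalSum-staircase-zero u |u|≡ℓ =
    pascalSum-vanish τ 1 u 0 (λ b b<u → subst (suc (τ b) ≤_) (+-comm 1 b) (s≤s (staircase-≤ (subst (b <_) |u|≡ℓ b<u))))

  pascalSum-staircase-period : ∀ d u → length u ≡ ℓ → ℓ < 2 ^ d → pascalSum τ 1 u (2 ^ d) ≡ false
  pascalSum-staircase-period d u |u|≡ℓ ℓ<M = begin
    pascalSum τ 1 u (2 ^ d)     ≡⟨ cong (pascalSum τ 1 u) (+-identityʳ (2 ^ d)) ⟨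
    pascalSum τ 1 u (2 ^ d + 0) ≡⟨ pascalSum-periodic d τ 1 u 0 b+1<M ⟩
    pascalSum τ 1 u 0           ≡⟨ pascalSum-staircase-zero u |u|≡ℓ ⟩
    false                       ∎
    where
    open ≡-Reasoning
    b+1<M : ∀ b → b < length u → b + 1 < 2 ^ d
    b+1<M b b<u = subst (_< 2 ^ d) (+-comm 1 b) (<-≤-trans (s≤s (subst (b <_) |u|≡ℓ b<u)) ℓ<M)

module _ {ℓ τ} (stair : Staircase (suc ℓ) τ) where

  staircase-stay : τ 1 ≡ 0 → Staircase ℓ (τ ∘ suc)
  staircase-stay τ₁≡0 = τ₁≡0 , λ b 1+b<ℓ → proj₂ stair (suc b) (s<s 1+b<ℓ)

  staircase-climb-positive : τ 1 ≡ 1 → ∀ {b} → b < ℓ → τ (suc b) ≡ suc (pred (τ (suc b)))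
  staircase-climb-positive τ₁≡1 b<ℓ =
    sym (suc-pred (τ _) {{>-nonZero (subst (_≤ τ _) τ₁≡1 (staircase-≥₁ stair (s<s b<ℓ)))}})

  staircase-climb : τ 1 ≡ 1 → Staircase ℓ (pred ∘ τ ∘ suc)
  staircase-climb τ₁≡1 = cong pred τ₁≡1 , step
    where
    step : ∀ b → suc b < ℓ → pred (τ (2 + b)) ≡ pred (τ (suc b)) ⊎ pred (τ (2 + b)) ≡ suc (pred (τ (suc b)))
    step b 1+b<ℓ with proj₂ stair (suc b) (s<s 1+b<ℓ)
    ... | inj₁ stay  = inj₁ (cong pred stay)
    ... | inj₂ climb = inj₂ (trans (cong pred climb) (staircase-climb-positive τ₁≡1 (<-trans (n<1+n b) 1+b<ℓ)))

-- Little-endian addition of the bit c; the final carry is dropped.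
addCarry : Bool → List Bool → List Bool
addCarry c []      = []
addCarry c (x ∷ s) = (x xor c) ∷ addCarry (x ∧ c) s

length-addCarry : ∀ c s → length (addCarry c s) ≡ length s
length-addCarry c []      = refl
length-addCarry c (x ∷ s) = cong suc (length-addCarry (x ∧ c) s)

addCarry-injective : ∀ c {s t} → addCarry c s ≡ addCarry c t → s ≡ t
addCarry-injective c {[]}    {[]}    _  = refl
addCarry-injective c {x ∷ s} {y ∷ t} eq with xor-cancelʳ c x y (∷-injectiveˡ eq)
... | refl = cong (x ∷_) (addCarry-injective (x ∧ c) (∷-injectiveʳ eq))

addCarry-false : ∀ s → addCarry false s ≡ s
addCarry-false []      = refl
addCarry-false (x ∷ s) = cong₂ _∷_ (xor-identityʳ x) (trans (cong (λ c → addCarry c s) (∧-zeroʳ x)) (addCarry-false s))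

module _ {ℓ τ} (stair : Staircase ℓ τ) (s t : List Bool) (|s|≡ℓ : length s ≡ ℓ) (|t|≡ℓ : length t ≡ ℓ) where

  agreeOn-difference-bottom : ∀ {n} → AgreeOn (pascalSum τ 1 s) (pascalSum τ 1 t) 1 n →
    AgreeOn (pascalSum τ 0 s) (pascalSum τ 0 t) 0 n
  agreeOn-difference-bottom agree = agreeOn-pascalSum-difference τ s t (agreeOn-cons at-0 agree)
    where
    at-0 : pascalSum τ 1 s 0 ≡ pascalSum τ 1 t 0
    at-0 = trans (pascalSum-staircase-zero stair s |s|≡ℓ) (sym (pascalSum-staircase-zero stair t |t|≡ℓ))

  agreeOn-difference-top : ∀ d {n} → ℓ < 2 ^ d → n ≤ 2 ^ d →
    AgreeOn (pascalSum τ 1 s) (pascalSum τ 1 t) (2 ^ d ∸ n) n →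
    AgreeOn (pascalSum τ 0 s) (pascalSum τ 0 t) (2 ^ d ∸ n) n
  agreeOn-difference-top d {n} ℓ<M n≤M agree = agreeOn-pascalSum-difference τ s t (agreeOn-snoc agree at-M)
    where
    at-M : pascalSum τ 1 s (2 ^ d ∸ n + n) ≡ pascalSum τ 1 t (2 ^ d ∸ n + n)
    at-M = subst (λ i → pascalSum τ 1 s i ≡ pascalSum τ 1 t i) (sym (m∸n+n≡m n≤M))
             (trans (pascalSum-staircase-period stair d s |s|≡ℓ ℓ<M) (sym (pascalSum-staircase-period stair d t |t|≡ℓ ℓ<M)))

pascalSum-climb-shift : ∀ {ℓ τ} → Staircase (suc ℓ) τ → τ 1 ≡ 1 → ∀ u → length u ≡ ℓ → ∀ i →
  pascalSum (τ ∘ suc) 1 u i ≡ pascalSum (pred ∘ τ ∘ suc) 1 u (suc i)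
pascalSum-climb-shift {τ = τ} stair τ₁≡1 u |u|≡ℓ i = pascalSum-shift (τ ∘ suc) (pred ∘ τ ∘ suc) 1 u i (suc i)
  (λ b b<u → trans (cong (i +_) (staircase-climb-positive stair τ₁≡1 (subst (b <_) |u|≡ℓ b<u))) (+-suc i _))

module _ (d : ℕ) {a h τ} (stair : Staircase (suc a + suc h) τ) (x y : Bool) (s t : List Bool)
         (|s| : length s ≡ a + suc h) (|t| : length t ≡ a + suc h) where

  wrap-stay-head : τ 1 ≡ 0 → ∀ c →
    AgreeOn (pascalSum τ 0 (addCarry c (x ∷ s))) (pascalSum τ 0 (addCarry c (y ∷ t))) 0 (suc h) → x ≡ y
  wrap-stay-head τ₁≡0 c bottom = xor-cancelʳ c x y (trans (sym (alone x s |s|)) (trans (agreeOn-first bottom) (alone y t |t|)))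
    where
    alone : ∀ z u → length u ≡ a + suc h → pascalSum τ 0 (addCarry c (z ∷ u)) 0 ≡ z xor c
    alone z u |u| = pascalSum-head-alone τ (z xor c) (addCarry (z ∧ c) u) 0
      (pascalSum-staircase-zero (staircase-stay stair τ₁≡0) (addCarry (z ∧ c) u) (trans (length-addCarry (z ∧ c) u) |u|))

  wrap-climb-head : suc a + suc h ≤ 2 ^ d → τ 1 ≡ 1 →
    AgreeOn (pascalSum τ 0 (x ∷ s)) (pascalSum τ 0 (y ∷ t)) (2 ^ d ∸ suc a) (suc a) → x ≡ y
  wrap-climb-head ℓ≤M τ₁≡1 top = trans (sym (alone x s |s|)) (trans (agreeOn-last top) (alone y t |t|))
    where
    M∸1+a≡M : suc (2 ^ d ∸ suc a + a) ≡ 2 ^ d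
    M∸1+a≡M = trans (sym (+-suc _ a)) (m∸n+n≡m (≤-trans (m≤m+n (suc a) (suc h)) ℓ≤M))
    alone : ∀ z u → length u ≡ a + suc h → pascalSum τ 0 (z ∷ u) (2 ^ d ∸ suc a + a) ≡ z
    alone z u |u| = pascalSum-head-alone τ z u _ (begin
      pascalSum (τ ∘ suc) 1 u (2 ^ d ∸ suc a + a)
        ≡⟨ pascalSum-climb-shift stair τ₁≡1 u |u| _ ⟩
      pascalSum (pred ∘ τ ∘ suc) 1 u (suc (2 ^ d ∸ suc a + a))
        ≡⟨ cong (pascalSum (pred ∘ τ ∘ suc) 1 u) M∸1+a≡M ⟩
      pascalSum (pred ∘ τ ∘ suc) 1 u (2 ^ d)
        ≡⟨ pascalSum-staircase-period (staircase-climb stair τ₁≡1) d u |u| ℓ≤M ⟩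
      false
        ∎)
      where open ≡-Reasoning

-- A window of length a + h starting at row 2^d - a reads the last a rows of the
-- Pascal sum of s and the first h rows of that of its successor addCarry c s.
-- Each differencing step costs one position of agreement; the staircase pays it
-- back with a value vanishing in row 0 (or 2^d) when it stays, and by shifting
-- the window by one row when it climbs.
wrap-around : ∀ d {ℓ τ} → Staircase ℓ τ → ℓ ≤ 2 ^ d → ∀ a h → a + h ≡ ℓ → ∀ c s t →
  length s ≡ ℓ → length t ≡ ℓ →
  AgreeOn (pascalSum τ 0 s) (pascalSum τ 0 t) (2 ^ d ∸ a) a →
  AgreeOn (pascalSum τ 0 (addCarry c s)) (pascalSum τ 0 (addCarry c t)) 0 h → s ≡ t
wrap-stay : ∀ d {a h τ} → Staircase (suc a + suc h) τ → suc a + suc h ≤ 2 ^ d → τ 1 ≡ 0 → ∀ c x y s t →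
  length s ≡ a + suc h → length t ≡ a + suc h →
  AgreeOn (pascalSum τ 0 (x ∷ s)) (pascalSum τ 0 (y ∷ t)) (2 ^ d ∸ suc a) (suc a) →
  AgreeOn (pascalSum τ 0 (addCarry c (x ∷ s))) (pascalSum τ 0 (addCarry c (y ∷ t))) 0 (suc h) → x ∷ s ≡ y ∷ t
wrap-climb : ∀ d {a h τ} → Staircase (suc a + suc h) τ → suc a + suc h ≤ 2 ^ d → τ 1 ≡ 1 → ∀ c x y s t →
  length s ≡ a + suc h → length t ≡ a + suc h →
  AgreeOn (pascalSum τ 0 (x ∷ s)) (pascalSum τ 0 (y ∷ t)) (2 ^ d ∸ suc a) (suc a) →
  AgreeOn (pascalSum τ 0 (addCarry c (x ∷ s))) (pascalSum τ 0 (addCarry c (y ∷ t))) 0 (suc h) → x ∷ s ≡ y ∷ t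

wrap-around d {τ = τ} stair ℓ≤M zero h refl c s t |s| |t| _ bottom =
  addCarry-injective c (pascalSum-window-injective τ (addCarry c s) (addCarry c t) |cs|≡|ct| 0
    (subst (AgreeOn _ _ 0) (sym (trans (length-addCarry c s) |s|)) bottom))
  where
  |cs|≡|ct| : length (addCarry c s) ≡ length (addCarry c t)
  |cs|≡|ct| = trans (length-addCarry c s) (trans |s| (sym (trans (length-addCarry c t) |t|)))
wrap-around d {τ = τ} stair ℓ≤M (suc a) zero refl c s t |s| |t| top _ =
  pascalSum-window-injective τ s t (trans |s| (sym |t|)) (2 ^ d ∸ suc a)
    (subst (AgreeOn _ _ _) (sym (trans |s| (+-identityʳ (suc a)))) top)
wrap-around d stair ℓ≤M (suc a) (suc h) refl c (x ∷ s) (y ∷ t) |x∷s| |y∷t| top bottom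
  with proj₂ stair 0 (s<s (≤-trans (s≤s z≤n) (m≤n+m (suc h) a)))
... | inj₁ stay  = wrap-stay d stair ℓ≤M (trans stay (proj₁ stair)) c x y s t
                     (suc-injective |x∷s|) (suc-injective |y∷t|) top bottom
... | inj₂ climb = wrap-climb d stair ℓ≤M (trans climb (cong suc (proj₁ stair))) c x y s t
                     (suc-injective |x∷s|) (suc-injective |y∷t|) top bottom

wrap-stay d {a} {h} {τ} stair ℓ≤M τ₁≡0 c x y s t |s| |t| top bottom
  with wrap-stay-head d stair x y s t |s| |t| τ₁≡0 c bottom
... | refl = cong (x ∷_) (wrap-around d stair′ (<⇒≤ ℓ≤M) (suc a) h (sym (+-suc a h)) (x ∧ c) s t |s| |t| top′ bottom′)
  where
  stair′ : Staircase (a + suc h) (τ ∘ suc)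
  stair′ = staircase-stay stair τ₁≡0
  top′ : AgreeOn (pascalSum (τ ∘ suc) 0 s) (pascalSum (τ ∘ suc) 0 t) (2 ^ d ∸ suc a) (suc a)
  top′ = agreeOn-difference-top stair′ s t |s| |t| d ℓ≤M (≤-trans (m≤m+n (suc a) (suc h)) ℓ≤M)
           (agreeOn-pascalSum-head τ x s t top)
  bottom′ : AgreeOn (pascalSum (τ ∘ suc) 0 (addCarry (x ∧ c) s)) (pascalSum (τ ∘ suc) 0 (addCarry (x ∧ c) t)) 0 h
  bottom′ = agreeOn-pascalSum-tail τ (x xor c) (x xor c) (addCarry (x ∧ c) s) (addCarry (x ∧ c) t) bottom

wrap-climb d {a} {h} {τ} stair ℓ≤M τ₁≡1 c x y s t |s| |t| top bottom
  with wrap-climb-head d stair x y s t |s| |t| ℓ≤M τ₁≡1 top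
... | refl = cong (x ∷_) (wrap-around d stair′ (<⇒≤ ℓ≤M) a (suc h) refl (x ∧ c) s t |s| |t| top′ bottom′)
  where
  τ′ = pred ∘ τ ∘ suc
  stair′ : Staircase (a + suc h) τ′
  stair′ = staircase-climb stair τ₁≡1
  shift : ∀ u → length u ≡ a + suc h → ∀ i → pascalSum (τ ∘ suc) 1 u i ≡ pascalSum τ′ 1 u (suc i)
  shift = pascalSum-climb-shift stair τ₁≡1
  cs = addCarry (x ∧ c) s
  ct = addCarry (x ∧ c) t
  |cs| : length cs ≡ a + suc h
  |cs| = trans (length-addCarry (x ∧ c) s) |s|
  |ct| : length ct ≡ a + suc h
  |ct| = trans (length-addCarry (x ∧ c) t) |t|
  M∸1+a≡M∸a : suc (2 ^ d ∸ suc a) ≡ 2 ^ d ∸ a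
  M∸1+a≡M∸a = sym (+-∸-assoc 1 (≤-trans (m≤m+n (suc a) (suc h)) ℓ≤M))
  top′ : AgreeOn (pascalSum τ′ 0 s) (pascalSum τ′ 0 t) (2 ^ d ∸ a) a
  top′ = agreeOn-pascalSum-difference τ′ s t
           (subst (λ lo → AgreeOn (pascalSum τ′ 1 s) (pascalSum τ′ 1 t) lo (suc a)) M∸1+a≡M∸a
             (agreeOn-suc (agreeOn-resp (shift s |s|) (shift t |t|) (agreeOn-pascalSum-head τ x s t top))))
  bottom′ : AgreeOn (pascalSum τ′ 0 cs) (pascalSum τ′ 0 ct) 0 (suc h)
  bottom′ = agreeOn-difference-bottom stair′ cs ct |cs| |ct|
              (agreeOn-suc (agreeOn-resp (shift cs |cs|) (shift ct |ct|) (agreeOn-pascalSum-head τ (x xor c) cs ct bottom)))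

length-filter-applyUpTo : ∀ {p} {P : ℕ → Set p} (P? : Decidable P) g n →
  length (filter P? (applyUpTo g n)) ≡ ∑[ i < n ] 𝟙 (P? (g i))
length-filter-applyUpTo P? g zero = refl
length-filter-applyUpTo P? g (suc n) with does (P? (g 0))
... | true  = cong suc (length-filter-applyUpTo P? (g ∘ suc) n)
... | false = length-filter-applyUpTo P? (g ∘ suc) n

code : List Bool → ℕ
code []      = 0
code (b ∷ u) = bitValue b + double (code u)

code-< : ∀ u → code u < 2 ^ length u
code-< []      = z<s
code-< (b ∷ u) = begin-strict
  bitValue b + double (code u)  <⟨ s≤s (+-monoˡ-≤ (double (code u)) (bitValue≤1 b)) ⟩
  double (suc (code u))         ≡⟨ double≡+ (suc (code u)) ⟩
  suc (code u) + suc (code u)   ≤⟨ +-mono-≤ (code-< u) (code-< u) ⟩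
  2 ^ length u + 2 ^ length u   ≡⟨ cong (2 ^ length u +_) (+-identityʳ (2 ^ length u)) ⟨
  2 ^ suc (length u)            ∎
  where
  open ≤-Reasoning
  bitValue≤1 : ∀ b → bitValue b ≤ 1
  bitValue≤1 false = z≤n
  bitValue≤1 true  = ≤-refl

code-injective : ∀ {u w} → length u ≡ length w → code u ≡ code w → u ≡ w
code-injective {[]}    {[]}    _       _    = refl
code-injective {b ∷ u} {c ∷ w} |u|≡|w| code≡ = cong₂ _∷_
  (trans (sym (lsb-bit+double b (code u))) (trans (cong lsb code≡) (lsb-bit+double c (code w))))
  (code-injective (suc-injective |u|≡|w|)
    (trans (sym (⌊bit+double/2⌋ b (code u))) (trans (cong ⌊_/2⌋ code≡) (⌊bit+double/2⌋ c (code w)))))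

fin-injective⇒surjective : ∀ {n} (f : Fin n → Fin n) → (∀ {i j} → f i ≡ f j → i ≡ j) → ∀ y → ∃ λ i → f i ≡ y
fin-injective⇒surjective {suc n} f f-injective y with any? (λ i → f i Fin.≟ y)
... | yes hit  = hit
... | no  miss = ⊥-elim (<-irrefl refl (injective⇒≤ punchOut∘f-injective))
  where
  punchOut∘f : Fin (suc n) → Fin n
  punchOut∘f i = punchOut {i = y} λ y≡fi → miss (i , sym y≡fi)
  punchOut∘f-injective : ∀ {i j} → punchOut∘f i ≡ punchOut∘f j → i ≡ j
  punchOut∘f-injective = f-injective ∘ punchOut-injective {i = y} _ _

allPairs-restrict : ∀ {a p r} {A : Set a} {P : A → Set p} {R : A → A → Set r} {xs} →
  All P xs → AllPairs (λ x y → P x → P y → R x y) xs → AllPairs R xs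
allPairs-restrict []         []         = []
allPairs-restrict (px ∷ pxs) (rx ∷ rxs) =
  All.zipWith (λ (r , py) → r px py) (rx , pxs) ∷ allPairs-restrict pxs rxs

window : Word → ℕ → ℕ → Word
window v ℓ j = take ℓ (drop j (v ++ v))

block-position-< : ∀ m N {s r} → s < N → r < m → s * m + r < m * N
block-position-< m N {s} {r} s<N r<m = begin-strict
  s * m + r   <⟨ +-monoʳ-< (s * m) r<m ⟩
  s * m + m   ≡⟨ +-comm (s * m) m ⟩
  suc s * m   ≤⟨ *-monoˡ-≤ m s<N ⟩
  N * m       ≡⟨ *-comm N m ⟩
  m * N       ∎
  where open ≤-Reasoning

-- Counting positions by residue class: a word of length ℓ occurs at most once
-- per class by injectivity, and at least once since an injection from the
-- 2^ℓ block indices into the 2^ℓ words of length ℓ is onto.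
module _ (m ℓ : ℕ) {{_ : NonZero m}} (v : Word) (|v| : length v ≡ m * 2 ^ ℓ)
         (window-injective : ∀ r {s s′} → r < m → s < 2 ^ ℓ → s′ < 2 ^ ℓ →
                             window v ℓ (s * m + r) ≡ window v ℓ (s′ * m + r) → s ≡ s′) where

  private
    N = 2 ^ ℓ

  length-window : ∀ {j} → j < m * N → length (window v ℓ j) ≡ ℓ
  length-window {j} j<L = trans (length-take ℓ (drop j (v ++ v))) (m≤n⇒m⊓n≡m (begin
    ℓ                             ≤⟨ <⇒≤ (n<2^n ℓ) ⟩
    N                             ≤⟨ m≤n*m N m ⟩
    m * N                         ≡⟨ m+n∸n≡m (m * N) j ⟨
    m * N + j ∸ j                 ≤⟨ ∸-monoˡ-≤ j (+-monoʳ-≤ (m * N) (<⇒≤ j<L)) ⟩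
    m * N + m * N ∸ j             ≡⟨ cong (λ n → n + n ∸ j) |v| ⟨
    length v + length v ∸ j       ≡⟨ cong (_∸ j) (length-++ v) ⟨
    length (v ++ v) ∸ j           ≡⟨ length-drop j (v ++ v) ⟨
    length (drop j (v ++ v))      ∎))
    where open ≤-Reasoning

  private
    code-<ℓ : ∀ w → length w ≡ ℓ → code w < N
    code-<ℓ w |w| = subst (λ n → code w < 2 ^ n) |w| (code-< w)

    |window| : ∀ {r} → r < m → (s : Fin N) → length (window v ℓ (toℕ s * m + r)) ≡ ℓ
    |window| r<m s = length-window (block-position-< m N (toℕ<n s) r<m)

    encode : ∀ {r} → r < m → Fin N → Fin N
    encode {r} r<m s = fromℕ< (code-<ℓ (window v ℓ (toℕ s * m + r)) (|window| r<m s))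

    toℕ-encode : ∀ {r} (r<m : r < m) s → toℕ (encode r<m s) ≡ code (window v ℓ (toℕ s * m + r))
    toℕ-encode r<m s = toℕ-fromℕ< _

    encode-injective : ∀ {r} (r<m : r < m) {s s′} → encode r<m s ≡ encode r<m s′ → s ≡ s′
    encode-injective {r} r<m {s} {s′} eq = toℕ-injective (window-injective r r<m (toℕ<n s) (toℕ<n s′)
      (code-injective (trans (|window| r<m s) (sym (|window| r<m s′)))
        (trans (sym (toℕ-encode r<m s)) (trans (cong toℕ eq) (toℕ-encode r<m s′)))))

  window-surjective : ∀ {r} → r < m → ∀ u → length u ≡ ℓ → ∃ λ s → s < N × window v ℓ (s * m + r) ≡ u
  window-surjective r<m u |u| with fin-injective⇒surjective (encode r<m) (encode-injective r<m) (fromℕ< (code-<ℓ u |u|))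
  ... | s , encode-s≡u = toℕ s , toℕ<n s ,
          code-injective (trans (|window| r<m s) (sym |u|))
            (trans (sym (toℕ-encode r<m s)) (trans (cong toℕ encode-s≡u) (toℕ-fromℕ< (code-<ℓ u |u|))))

  private
    residue-block : ∀ j → j ≡ (j / m) * m + j % m
    residue-block j = trans (m≡m%n+[m/n]*n j m) (+-comm (j % m) _)

    window-ℓ : ∀ {u} → length u ≡ ℓ → ∀ j → window v (length u) j ≡ u → window v ℓ j ≡ u
    window-ℓ {u} |u| j = subst (λ n → window v n j ≡ u) |u|

  occurrences-length : ∀ u → length u ≡ ℓ → length (occurrences v u) ≡ m
  occurrences-length u |u| = begin
    length (filter (occursAt? v u) (upTo (length v)))
      ≡⟨ cong (λ n → length (filter (occursAt? v u) (upTo n))) (trans |v| (*-comm m N)) ⟩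
    length (filter (occursAt? v u) (upTo (N * m)))
      ≡⟨ length-filter-applyUpTo (occursAt? v u) (λ j → j) (N * m) ⟩
    ∑[ j < N * m ] 𝟙 (occursAt? v u j)
      ≡⟨ ∑-blocks m N _ ⟩
    ∑[ s < N ] ∑[ r < m ] 𝟙 (occursAt? v u (s * m + r))
      ≡⟨ ∑-swap m N (λ s r → 𝟙 (occursAt? v u (s * m + r))) ⟩
    ∑[ r < m ] ∑[ s < N ] 𝟙 (occursAt? v u (s * m + r))
      ≡⟨ ∑-cong m once-per-class ⟩
    ∑[ r < m ] 1
      ≡⟨ ∑-one m ⟩
    m
      ∎
    where
    open ≡-Reasoning
    once-per-class : ∀ r → r < m → ∑[ s < N ] 𝟙 (occursAt? v u (s * m + r)) ≡ 1
    once-per-class r r<m = once (window-surjective r<m u |u|)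
      where
      once : (∃ λ s₀ → s₀ < N × window v ℓ (s₀ * m + r) ≡ u) → ∑[ s < N ] 𝟙 (occursAt? v u (s * m + r)) ≡ 1
      once (s₀ , s₀<N , hit) = ∑-𝟙-unique (λ s → occursAt? v u (s * m + r)) N s₀<N
        (subst (λ n → window v n (s₀ * m + r) ≡ u) (sym |u|) hit)
        (λ s s<N occ → window-injective r r<m s<N s₀<N (trans (window-ℓ |u| (s * m + r) occ) (sym hit)))

  occurrences-incongruent : ∀ u → length u ≡ ℓ → AllPairs (Incongruent m) (occurrences v u)
  occurrences-incongruent u |u| =
    allPairs-restrict (all-filter (occursAt? v u) (upTo (length v)))
      (filter⁺ (occursAt? v u) (applyUpTo⁺₁ (λ j → j) (length v) distinct-classes))
    where
    distinct-classes : ∀ {i j} → i < j → j < length v →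
      window v (length u) i ≡ u → window v (length u) j ≡ u → Incongruent m i j
    distinct-classes {i} {j} i<j j<L occ-i occ-j m∣j-i = <-irrefl i≡j i<j
      where
      j%m≡i%m : j % m ≡ i % m
      j%m≡i%m = trans (cong (_% m) (sym (m+[n∸m]≡n (<⇒≤ i<j))))
                      (%-remove-+ʳ i (subst (m ∣_) (m≤n⇒∣m-n∣≡n∸m (<⇒≤ i<j)) m∣j-i))
      block< : ∀ k → k < length v → k / m < N
      block< k k<L = m<n*o⇒m/o<n (subst (k <_) (trans |v| (*-comm m N)) k<L)
      same-block : i / m ≡ j / m
      same-block = window-injective (i % m) (m%n<n i m) (block< i (<-trans i<j j<L)) (block< j j<L)
        (trans (cong (window v ℓ) (sym (residue-block i)))
          (trans (window-ℓ |u| i occ-i) (trans (sym (window-ℓ |u| j occ-j))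
            (cong (window v ℓ) (trans (residue-block j) (cong (j / m * m +_) j%m≡i%m))))))
      i≡j : i ≡ j
      i≡j = trans (residue-block i) (trans (cong₂ (λ q r → q * m + r) same-block (sym j%m≡i%m)) (sym (residue-block j)))

  perfectNecklace-criterion : PerfectNecklace ℓ m v
  perfectNecklace-criterion = |v| , λ u |u| → occurrences-length u |u| , occurrences-incongruent u |u|

length-allWords : ∀ n → length (allWords n) ≡ 2 ^ n
length-allWords zero    = refl
length-allWords (suc n) = begin
  length (map (false Vec.∷_) (allWords n) ++ map (true Vec.∷_) (allWords n))
    ≡⟨ length-++ (map (false Vec.∷_) (allWords n)) ⟩
  length (map (false Vec.∷_) (allWords n)) + length (map (true Vec.∷_) (allWords n))
    ≡⟨ cong₂ _+_ (length-map (false Vec.∷_) (allWords n)) (length-map (true Vec.∷_) (allWords n)) ⟩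
  length (allWords n) + length (allWords n)
    ≡⟨ cong (λ k → k + k) (length-allWords n) ⟩
  2 ^ n + 2 ^ n
    ≡⟨ cong (2 ^ n +_) (+-identityʳ (2 ^ n)) ⟨
  2 ^ suc n
    ∎
  where open ≡-Reasoning

word : (n : ℕ) → ℕ → Vec Bool n
word n = nth (Vec.replicate n false) (allWords n)

word-lower : ∀ n {S} → S < 2 ^ n → word (suc n) S ≡ false Vec.∷ word n S
word-lower n {S} S<M =
  trans (nth-++ˡ _ (map (false Vec.∷_) (allWords n)) _ (subst (S <_) (sym |lower|) S<M))
        (nth-map (false Vec.∷_) (allWords n) (subst (S <_) (sym (length-allWords n)) S<M))
  where
  |lower| : length (map (false Vec.∷_) (allWords n)) ≡ 2 ^ n
  |lower| = trans (length-map (false Vec.∷_) (allWords n)) (length-allWords n)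

word-upper : ∀ n {S} → S < 2 ^ n → word (suc n) (2 ^ n + S) ≡ true Vec.∷ word n S
word-upper n {S} S<M =
  trans (cong (nth _ (map (false Vec.∷_) (allWords n) ++ map (true Vec.∷_) (allWords n))) (cong (_+ S) (sym |lower|)))
        (trans (nth-++ʳ _ (map (false Vec.∷_) (allWords n)) _ S)
               (nth-map (true Vec.∷_) (allWords n) (subst (S <_) (sym (length-allWords n)) S<M)))
  where
  |lower| : length (map (false Vec.∷_) (allWords n)) ≡ 2 ^ n
  |lower| = trans (length-map (false Vec.∷_) (allWords n)) (length-allWords n)

-- word n S is the n-bit expansion of S, most significant bit first; by Lucas,
-- bit b of S is binom₂ S (2 ^ b).
word-bit : ∀ n {S b} → S < 2 ^ n → b < n → toList (word n S) ‼ (n ∸ 1 ∸ b) ≡ binom₂ S (2 ^ b)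
word-bit (suc n) {b = b} S<2M b<1+n with halves n S<2M | m≤n⇒m<n∨m≡n (s≤s⁻¹ b<1+n)
... | lower {S} S<M | inj₂ refl rewrite word-lower n S<M | n∸n≡0 n = sym (binom₂-< S<M)
... | lower {S} S<M | inj₁ b<n  rewrite word-lower n S<M | ∸≡suc∸1∸ b<n = word-bit n S<M b<n
... | upper {S} S<M | inj₂ refl rewrite word-upper n S<M | n∸n≡0 n =
  sym (trans (cong (binom₂ (2 ^ n + S)) (sym (+-identityʳ (2 ^ n))))
             (trans (binom₂-+-+ n S<M (m^n>0 2 n)) (binom₂-zeroʳ S)))
... | upper {S} S<M | inj₁ b<n  rewrite word-upper n S<M | ∸≡suc∸1∸ b<n =
  trans (word-bit n S<M b<n) (sym (binom₂-periodic n S (^-monoʳ-< 2 (s≤s (s≤s z≤n)) b<n)))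

bits : ℕ → ℕ → List Bool
bits zero    s = []
bits (suc ℓ) s = lsb s ∷ bits ℓ ⌊ s /2⌋

length-bits : ∀ ℓ s → length (bits ℓ s) ≡ ℓ
length-bits zero    s = refl
length-bits (suc ℓ) s = cong suc (length-bits ℓ ⌊ s /2⌋)

bits-bit+double : ∀ ℓ e h → bits (suc ℓ) (bitValue e + double h) ≡ e ∷ bits ℓ h
bits-bit+double ℓ e h = cong₂ (λ b n → b ∷ bits ℓ n) (lsb-bit+double e h) (⌊bit+double/2⌋ e h)

bits-injective : ∀ ℓ {s s′} → s < 2 ^ ℓ → s′ < 2 ^ ℓ → bits ℓ s ≡ bits ℓ s′ → s ≡ s′
bits-injective zero    {zero}  {zero}  _ _ _ = refl
bits-injective zero    {suc s} (s<s ()) _ _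
bits-injective zero    {s′ = suc s′} _ (s<s ()) _
bits-injective (suc ℓ) {s} {s′} s<2M s′<2M bits≡ = begin
  s                                    ≡⟨ lsb+double-⌊/2⌋ s ⟨
  bitValue (lsb s) + double ⌊ s /2⌋     ≡⟨ cong₂ (λ e h → bitValue e + double h) (∷-injectiveˡ bits≡)
                                           (bits-injective ℓ (⌊/2⌋-< s _ s<2M) (⌊/2⌋-< s′ _ s′<2M) (∷-injectiveʳ bits≡)) ⟩
  bitValue (lsb s′) + double ⌊ s′ /2⌋   ≡⟨ lsb+double-⌊/2⌋ s′ ⟩
  s′                                   ∎
  where open ≡-Reasoning

‼-bits : ∀ ℓ s {b} → b < ℓ → bits ℓ s ‼ b ≡ binom₂ s (2 ^ b)
‼-bits (suc ℓ) s {zero} _ = sym (begin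
  binom₂ s 1                                             ≡⟨ cong (λ n → binom₂ n 1) (lsb+double-⌊/2⌋ s) ⟨
  binom₂ (bitValue (lsb s) + double ⌊ s /2⌋) (bitValue true + double 0)
                                                         ≡⟨ binom₂-lucas-bit (lsb s) true ⌊ s /2⌋ 0 ⟩
  binom₂ ⌊ s /2⌋ 0 ∧ binom₂ (bitValue (lsb s)) 1         ≡⟨ cong (_∧ binom₂ (bitValue (lsb s)) 1) (binom₂-zeroʳ ⌊ s /2⌋) ⟩
  binom₂ (bitValue (lsb s)) 1                            ≡⟨ binom₂-bit-1 (lsb s) ⟩
  lsb s                                                  ∎)
  where
  open ≡-Reasoning
  binom₂-bit-1 : ∀ e → binom₂ (bitValue e) 1 ≡ e
  binom₂-bit-1 false = refl
  binom₂-bit-1 true  = refl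
‼-bits (suc ℓ) s {suc b} (s<s b<ℓ) = begin
  bits ℓ ⌊ s /2⌋ ‼ b
    ≡⟨ ‼-bits ℓ ⌊ s /2⌋ b<ℓ ⟩
  binom₂ ⌊ s /2⌋ (2 ^ b)
    ≡⟨ ∧-identityʳ _ ⟨
  binom₂ ⌊ s /2⌋ (2 ^ b) ∧ true
    ≡⟨ cong (binom₂ ⌊ s /2⌋ (2 ^ b) ∧_) (binom₂-zeroʳ (bitValue (lsb s))) ⟨
  binom₂ ⌊ s /2⌋ (2 ^ b) ∧ binom₂ (bitValue (lsb s)) (bitValue false)
                                                         ≡⟨ binom₂-lucas-bit (lsb s) false ⌊ s /2⌋ (2 ^ b) ⟨
  binom₂ (bitValue (lsb s) + double ⌊ s /2⌋) (double (2 ^ b))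
                                                         ≡⟨ cong₂ binom₂ (lsb+double-⌊/2⌋ s) (sym (2^suc≡double b)) ⟩
  binom₂ s (2 ^ suc b)                                   ∎
  where open ≡-Reasoning

bits-suc : ∀ ℓ s → addCarry true (bits ℓ s) ≡ bits ℓ (suc s)
bits-suc zero    s = refl
bits-suc (suc ℓ) s = subst (λ n → addCarry true (bits (suc ℓ) n) ≡ bits (suc ℓ) (suc n)) (lsb+double-⌊/2⌋ s)
                           (by-parity (lsb s) ⌊ s /2⌋)
  where
  by-parity : ∀ e h → addCarry true (bits (suc ℓ) (bitValue e + double h)) ≡ bits (suc ℓ) (suc (bitValue e + double h))
  by-parity false h = begin
    addCarry true (bits (suc ℓ) (double h))   ≡⟨ cong (addCarry true) (bits-bit+double ℓ false h) ⟩
    true ∷ addCarry false (bits ℓ h)          ≡⟨ cong (true ∷_) (addCarry-false (bits ℓ h)) ⟩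
    true ∷ bits ℓ h                           ≡⟨ bits-bit+double ℓ true h ⟨
    bits (suc ℓ) (suc (double h))             ∎
    where open ≡-Reasoning
  by-parity true h = begin
    addCarry true (bits (suc ℓ) (suc (double h)))  ≡⟨ cong (addCarry true) (bits-bit+double ℓ true h) ⟩
    false ∷ addCarry true (bits ℓ h)               ≡⟨ cong (false ∷_) (bits-suc ℓ h) ⟩
    false ∷ bits ℓ (suc h)                         ≡⟨ bits-bit+double ℓ false (suc h) ⟨
    bits (suc ℓ) (double (suc h))                  ∎
    where open ≡-Reasoning

bits-wrap : ∀ ℓ → bits ℓ (2 ^ ℓ) ≡ bits ℓ 0
bits-wrap zero    = refl
bits-wrap (suc ℓ) = trans (cong (bits (suc ℓ)) (2^suc≡double ℓ))
                          (trans (bits-bit+double ℓ false (2 ^ ℓ)) (cong (false ∷_) (bits-wrap ℓ)))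

pascalSum-bits : ∀ τ ℓ s i → pascalSum τ 0 (bits ℓ s) i ≡ ⨁[ b < ℓ ] (binom₂ (i + τ b) b ∧ binom₂ s (2 ^ b))
pascalSum-bits τ ℓ s i = begin
  pascalSum τ 0 (bits ℓ s) i
    ≡⟨ pascalSum-⨁ τ 0 (bits ℓ s) i ⟩
  ⨁[ b < length (bits ℓ s) ] (bits ℓ s ‼ b ∧ binom₂ (i + τ b) (b + 0))
    ≡⟨ cong (λ n → ⨁[ b < n ] (bits ℓ s ‼ b ∧ binom₂ (i + τ b) (b + 0))) (length-bits ℓ s) ⟩
  ⨁[ b < ℓ ] (bits ℓ s ‼ b ∧ binom₂ (i + τ b) (b + 0))
    ≡⟨ ⨁-cong ℓ (λ b b<ℓ → trans (∧-comm (bits ℓ s ‼ b) _)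
                                  (cong₂ _∧_ (cong (binom₂ (i + τ b)) (+-identityʳ b)) (‼-bits ℓ s b<ℓ))) ⟩
  ⨁[ b < ℓ ] (binom₂ (i + τ b) b ∧ binom₂ s (2 ^ b))
    ∎
  where open ≡-Reasoning

-- Affine necklaces

-- The exponents n_1, …, n_m are read from the last column backwards: the
-- column 2^d - 1 - b is rotated by ns (m ∸ 1 ∸ b), and τ b is the row offset it
-- leaves in the Pascal pattern binom (i + τ b) b.
module _ {m ns} (adm : Admissible m ns) where

  pathOf : ℕ → ℕ
  pathOf b = b ∸ ns (m ∸ 1 ∸ b)

  private
    index-suc : ∀ {b} → suc b < m → suc (m ∸ 1 ∸ suc b) ≡ m ∸ 1 ∸ b
    index-suc {b} 1+b<m = sym (trans (∸≡suc∸1∸ (∸-monoˡ-≤ 1 1+b<m)) (cong suc (∸-+-assoc (m ∸ 1) 1 b)))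

    step : ∀ {b} → suc b < m → ns (m ∸ 1 ∸ b) ≤ ns (m ∸ 1 ∸ suc b) × ns (m ∸ 1 ∸ suc b) ≤ suc (ns (m ∸ 1 ∸ b))
    step {b} 1+b<m = subst (λ i → ns i ≤ ns (m ∸ 1 ∸ suc b) × ns (m ∸ 1 ∸ suc b) ≤ suc (ns i)) (index-suc 1+b<m)
      (proj₂ adm (m ∸ 1 ∸ suc b) (subst (_< m) (sym (index-suc 1+b<m)) (∸1∸-< b (<-trans z<s 1+b<m))))

  admissible-≤ : ∀ {b} → b < m → ns (m ∸ 1 ∸ b) ≤ b
  admissible-≤ {zero}  _     = ≤-reflexive (proj₁ adm)
  admissible-≤ {suc b} 1+b<m = ≤-trans (proj₂ (step 1+b<m)) (s≤s (admissible-≤ (<-trans (n<1+n b) 1+b<m)))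

  admissible-staircase : ∀ {ℓ} → ℓ ≤ m → Staircase ℓ pathOf
  admissible-staircase ℓ≤m = 0∸n≡0 (ns (m ∸ 1 ∸ 0)) , λ b 1+b<ℓ → climb-or-stay (<-≤-trans 1+b<ℓ ℓ≤m)
    where
    climb-or-stay : ∀ {b} → suc b < m → pathOf (suc b) ≡ pathOf b ⊎ pathOf (suc b) ≡ suc (pathOf b)
    climb-or-stay {b} 1+b<m with ≤-≤suc⇒≡⊎≡suc (proj₁ (step 1+b<m)) (proj₂ (step 1+b<m))
    ... | inj₁ same = inj₂ (trans (cong (suc b ∸_) same) (+-∸-assoc 1 (admissible-≤ (<-trans (n<1+n b) 1+b<m))))
    ... | inj₂ more = inj₁ (cong (suc b ∸_) more)

module _ (d : ℕ) {ns} (adm : Admissible (2 ^ d) ns) (z : Vec Bool (2 ^ d)) where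

  private
    m = 2 ^ d
    τ = pathOf adm

  codeword : Vec Bool m → List Bool
  codeword w = toList (mulCols (shiftedColumn d ns) (w ⊕ z))

  block : ℕ → List Bool
  block S = codeword (word m S)

  columnEntry : ℕ → ℕ → Bool
  columnEntry j i = binom₂ (i + τ (m ∸ 1 ∸ j)) (m ∸ 1 ∸ j)

  ‼-shiftedColumn : ∀ {j i} (j<m : j < m) → i < m → toList (shiftedColumn d ns (fromℕ< j<m)) ‼ i ≡ columnEntry j i
  ‼-shiftedColumn {j} {i} j<m i<m =
    trans (‼-σ^-column d (fromℕ< j<m) j≡ (2^∸1∸-< d j) n≤b i<m) (cong (λ k → binom₂ (i + (b ∸ ns k)) b) j≡)
    where
    b = m ∸ 1 ∸ j
    m∸1∸b≡j : m ∸ 1 ∸ b ≡ j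
    m∸1∸b≡j = m∸[m∸n]≡n (∸-monoˡ-≤ 1 j<m)
    j≡ : toℕ (fromℕ< j<m) ≡ m ∸ 1 ∸ b
    j≡ = trans (toℕ-fromℕ< j<m) (sym m∸1∸b≡j)
    n≤b : ns (toℕ (fromℕ< j<m)) ≤ b
    n≤b = subst (λ k → ns k ≤ b) (sym j≡) (admissible-≤ adm (2^∸1∸-< d j))

  ‼-codeword : ∀ (w : Vec Bool m) {i} → i < m → codeword w ‼ i ≡ ⨁[ j < m ] (columnEntry j i ∧ (toList w ‼ j xor toList z ‼ j))
  ‼-codeword w {i} i<m = trans (‼-mulCols (shiftedColumn d ns) (w ⊕ z) i<m (λ j → columnEntry j i) (λ j<m → ‼-shiftedColumn j<m i<m))
    (⨁-cong m (λ j j<m → cong (columnEntry j i ∧_) (‼-zipWith _xor_ w z j<m)))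

  translationPart : ℕ → Bool
  translationPart i = ⨁[ j < m ] (columnEntry j i ∧ toList z ‼ j)

  ‼-block-bits : ∀ {S i} → S < 2 ^ m → i < m →
    block S ‼ i ≡ ⨁[ b < m ] (binom₂ (i + τ b) b ∧ binom₂ S (2 ^ b)) xor translationPart i
  ‼-block-bits {S} {i} S<2^m i<m = begin
    block S ‼ i
      ≡⟨ ‼-codeword (word m S) i<m ⟩
    ⨁[ j < m ] (columnEntry j i ∧ (toList (word m S) ‼ j xor toList z ‼ j))
      ≡⟨ ⨁-cong m (λ j _ → ∧-distribˡ-xor (columnEntry j i) _ _) ⟩
    ⨁[ j < m ] ((columnEntry j i ∧ toList (word m S) ‼ j) xor (columnEntry j i ∧ toList z ‼ j))
      ≡⟨ ⨁-xor m _ _ ⟩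
    ⨁[ j < m ] (columnEntry j i ∧ toList (word m S) ‼ j) xor translationPart i
      ≡⟨ cong (_xor translationPart i) (trans (⨁-reverse m _) (⨁-cong m by-bit)) ⟩
    ⨁[ b < m ] (binom₂ (i + τ b) b ∧ binom₂ S (2 ^ b)) xor translationPart i
      ∎
    where
    open ≡-Reasoning
    by-bit : ∀ b → b < m → columnEntry (m ∸ 1 ∸ b) i ∧ toList (word m S) ‼ (m ∸ 1 ∸ b) ≡ binom₂ (i + τ b) b ∧ binom₂ S (2 ^ b)
    by-bit b b<m = cong₂ _∧_ (cong (λ k → binom₂ (i + τ k) k) (m∸[m∸n]≡n (∸-monoˡ-≤ 1 b<m))) (word-bit m S<2^m b<m)

  -- Row i of the block 2^ℓ T + s, minus the contribution of the low bits s.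
  affinePart : ℕ → ℕ → ℕ → Bool
  affinePart ℓ T i = (⨁[ b < m ∸ ℓ ] (binom₂ (i + τ (ℓ + b)) (ℓ + b) ∧ binom₂ T (2 ^ b))) xor translationPart i

  ‼-block : ∀ ℓ T {s i} → ℓ ≤ m → s < 2 ^ ℓ → 2 ^ ℓ * T + s < 2 ^ m → i < m →
    block (2 ^ ℓ * T + s) ‼ i ≡ affinePart ℓ T i xor pascalSum τ 0 (bits ℓ s) i
  ‼-block ℓ T {s} {i} ℓ≤m s<2^ℓ S<2^m i<m = begin
    block S ‼ i                                         ≡⟨ ‼-block-bits S<2^m i<m ⟩
    ⨁ m f xor Z                                         ≡⟨ cong (λ n → ⨁ n f xor Z) (m+[n∸m]≡n ℓ≤m) ⟨
    ⨁ (ℓ + (m ∸ ℓ)) f xor Z                             ≡⟨ cong (_xor Z) (⨁-+ ℓ (m ∸ ℓ) f) ⟩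
    (⨁ ℓ f xor ⨁[ b < m ∸ ℓ ] f (ℓ + b)) xor Z          ≡⟨ cong₂ (λ p q → (p xor q) xor Z) low high ⟩
    (pascalSum τ 0 (bits ℓ s) i xor H) xor Z            ≡⟨ xor-assoc (pascalSum τ 0 (bits ℓ s) i) H Z ⟩
    pascalSum τ 0 (bits ℓ s) i xor (H xor Z)            ≡⟨ xor-comm (pascalSum τ 0 (bits ℓ s) i) _ ⟩
    affinePart ℓ T i xor pascalSum τ 0 (bits ℓ s) i     ∎
    where
    open ≡-Reasoning
    S = 2 ^ ℓ * T + s
    Z = translationPart i
    H = ⨁[ b < m ∸ ℓ ] (binom₂ (i + τ (ℓ + b)) (ℓ + b) ∧ binom₂ T (2 ^ b))
    f : ℕ → Bool
    f b = binom₂ (i + τ b) b ∧ binom₂ S (2 ^ b)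
    low : ⨁ ℓ f ≡ pascalSum τ 0 (bits ℓ s) i
    low = trans (⨁-cong ℓ (λ b b<ℓ → cong (binom₂ (i + τ b) b ∧_) (binom₂-low-bit ℓ T s<2^ℓ b<ℓ)))
                (sym (pascalSum-bits τ ℓ s i))
    high : ⨁[ b < m ∸ ℓ ] f (ℓ + b) ≡ H
    high = ⨁-cong (m ∸ ℓ) (λ b _ → cong (binom₂ (i + τ (ℓ + b)) (ℓ + b) ∧_) (binom₂-high-bit ℓ T s<2^ℓ b))

module _ (d k : ℕ) (k≤m : k ≤ 2 ^ d) {ns} (adm : Admissible (2 ^ d) ns) (z : Vec Bool (2 ^ d)) where

  private
    m = 2 ^ d
    τ = pathOf adm
    w = affineNecklace d k ns z
    words = take (2 ^ k) (allWords m)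

    2^k≤2^m : 2 ^ k ≤ 2 ^ m
    2^k≤2^m = ^-monoʳ-≤ 2 k≤m

    |words| : length words ≡ 2 ^ k
    |words| = trans (length-take (2 ^ k) (allWords m)) (trans (cong (2 ^ k ⊓_) (length-allWords m)) (m≤n⇒m⊓n≡m 2^k≤2^m))

    |codeword| : ∀ x → length (codeword d adm z x) ≡ m
    |codeword| x = length-toList (mulCols (shiftedColumn d ns) (x ⊕ z))

  length-affineNecklace : length w ≡ m * 2 ^ k
  length-affineNecklace = trans (length-concatMap (codeword d adm z) |codeword| words)
                                (trans (cong (_* m) |words|) (*-comm (2 ^ k) m))

  ‼-affineNecklace : ∀ {S i} → S < 2 ^ k → i < m → w ‼ (S * m + i) ≡ block d adm z S ‼ i
  ‼-affineNecklace {S} {i} S<2^k i<m =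
    trans (‼-concatMap (codeword d adm z) |codeword| (Vec.replicate m false) words (subst (S <_) (sym |words|) S<2^k) i<m)
          (cong (λ x → codeword d adm z x ‼ i) (nth-take _ (2 ^ k) (allWords m) S<2^k))

  module Factor (ℓ t : ℕ) (ℓ≤k : ℓ ≤ k) (fits : t * (m * 2 ^ ℓ) + m * 2 ^ ℓ ≤ length w) where

    private
      P = 2 ^ ℓ
      L = m * P
      ℓ≤m : ℓ ≤ m
      ℓ≤m = ≤-trans ℓ≤k k≤m
      L≤|w|∸tL : L ≤ length w ∸ t * L
      L≤|w|∸tL = m+n≤o⇒m≤o∸n L (subst (_≤ length w) (+-comm (t * L) L) fits)

    factor : List Bool
    factor = take L (drop (t * L) w)

    length-factor : length factor ≡ L
    length-factor = trans (length-take L (drop (t * L) w)) (m≤n⇒m⊓n≡m (subst (L ≤_) (sym (length-drop (t * L) w)) L≤|w|∸tL))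

    block-index-< : ∀ {s} → s < P → P * t + s < 2 ^ k
    block-index-< {s} s<P = *-cancelʳ-< m _ _ (begin-strict
      (P * t + s) * m
        ≡⟨ solve 4 (λ t m P s → (P :* t :+ s) :* m := t :* (m :* P) :+ s :* m) refl t m P s ⟩
      t * L + s * m
        <⟨ +-monoʳ-< (t * L) (subst (_< L) (+-identityʳ (s * m)) (block-position-< m P s<P (m^n>0 2 d))) ⟩
      t * L + L
        ≤⟨ fits ⟩
      length w
        ≡⟨ trans length-affineNecklace (*-comm m (2 ^ k)) ⟩
      2 ^ k * m
        ∎)
      where open ≤-Reasoning

    ‼-factor : ∀ {s i} → s < P → i < m → factor ‼ (s * m + i) ≡ affinePart d adm z ℓ t i xor pascalSum τ 0 (bits ℓ s) i
    ‼-factor {s} {i} s<P i<m = begin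
      factor ‼ (s * m + i)
        ≡⟨ nth-take false L (drop (t * L) w) (block-position-< m P s<P i<m) ⟩
      drop (t * L) w ‼ (s * m + i)
        ≡⟨ nth-drop false (t * L) w (s * m + i) ⟩
      w ‼ (t * L + (s * m + i))
        ≡⟨ cong (w ‼_) (solve 5 (λ t m P s i → t :* (m :* P) :+ (s :* m :+ i) := (P :* t :+ s) :* m :+ i) refl t m P s i) ⟩
      w ‼ ((P * t + s) * m + i)
        ≡⟨ ‼-affineNecklace (block-index-< s<P) i<m ⟩
      block d adm z (P * t + s) ‼ i
        ≡⟨ ‼-block d adm z ℓ t ℓ≤m s<P (<-≤-trans (block-index-< s<P) 2^k≤2^m) i<m ⟩
      affinePart d adm z ℓ t i xor pascalSum τ 0 (bits ℓ s) i
        ∎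
      where
      open ≡-Reasoning

    private
      affine = affinePart d adm z ℓ t

    ‼-factor-twice : ∀ {s q} → s ≤ P → q < m → (factor ++ factor) ‼ (s * m + q) ≡ affine q xor pascalSum τ 0 (bits ℓ s) q
    ‼-factor-twice {s} {q} s≤P q<m with m≤n⇒m<n∨m≡n s≤P
    ... | inj₁ s<P = trans (nth-++ˡ false factor factor (subst (s * m + q <_) (sym length-factor) (block-position-< m P s<P q<m)))
                           (‼-factor s<P q<m)
    ... | inj₂ refl = begin
      (factor ++ factor) ‼ (P * m + q)
        ≡⟨ cong (λ n → (factor ++ factor) ‼ (n + q)) (trans (*-comm P m) (sym length-factor)) ⟩
      (factor ++ factor) ‼ (length factor + q)
        ≡⟨ nth-++ʳ false factor factor q ⟩
      factor ‼ q
        ≡⟨ ‼-factor (m^n>0 2 ℓ) q<m ⟩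
      affine q xor pascalSum τ 0 (bits ℓ 0) q
        ≡⟨ cong (λ u → affine q xor pascalSum τ 0 u q) (bits-wrap ℓ) ⟨
      affine q xor pascalSum τ 0 (bits ℓ P) q
        ∎
      where open ≡-Reasoning

    ‼-window : ∀ j {a} → a < ℓ → window factor ℓ j ‼ a ≡ (factor ++ factor) ‼ (j + a)
    ‼-window j a<ℓ = trans (nth-take false ℓ (drop j (factor ++ factor)) a<ℓ) (nth-drop false j (factor ++ factor) _)

    window-inside : ∀ {r s a} → s < P → a < ℓ → r + a < m →
      window factor ℓ (s * m + r) ‼ a ≡ affine (r + a) xor pascalSum τ 0 (bits ℓ s) (r + a)
    window-inside {r} {s} {a} s<P a<ℓ r+a<m =
      trans (‼-window (s * m + r) a<ℓ) (trans (cong ((factor ++ factor) ‼_) (+-assoc (s * m) r a)) (‼-factor-twice (<⇒≤ s<P) r+a<m))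

    window-across : ∀ {r s a} → r < m → s < P → a < ℓ → m ≤ r + a →
      window factor ℓ (s * m + r) ‼ a ≡ affine (r + a ∸ m) xor pascalSum τ 0 (addCarry true (bits ℓ s)) (r + a ∸ m)
    window-across {r} {s} {a} r<m s<P a<ℓ m≤r+a = begin
      window factor ℓ (s * m + r) ‼ a           ≡⟨ ‼-window (s * m + r) a<ℓ ⟩
      (factor ++ factor) ‼ (s * m + r + a)      ≡⟨ cong ((factor ++ factor) ‼_) position ⟩
      (factor ++ factor) ‼ (suc s * m + q)      ≡⟨ ‼-factor-twice s<P q<m ⟩
      affine q xor pascalSum τ 0 (bits ℓ (suc s)) q
                                                ≡⟨ cong (λ u → affine q xor pascalSum τ 0 u q) (bits-suc ℓ s) ⟨
      affine q xor pascalSum τ 0 (addCarry true (bits ℓ s)) q ∎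
      where
      open ≡-Reasoning
      q = r + a ∸ m
      q<m : q < m
      q<m = +-cancelˡ-< m q m (subst (_< m + m) (sym (m+[n∸m]≡n m≤r+a)) (+-mono-< r<m (<-≤-trans a<ℓ ℓ≤m)))
      position : s * m + r + a ≡ suc s * m + q
      position = trans (+-assoc (s * m) r a) (trans (cong (s * m +_) (sym (m+[n∸m]≡n m≤r+a)))
                   (solve 3 (λ s m q → s :* m :+ (m :+ q) := m :+ s :* m :+ q) refl s m q))

    module _ {r s s′} (r<m : r < m) (s<P : s < P) (s′<P : s′ < P)
             (same : window factor ℓ (s * m + r) ≡ window factor ℓ (s′ * m + r)) where

      private
        pascalBits : ℕ → ℕ → Bool
        pascalBits u = pascalSum τ 0 (bits ℓ u)
        pascalNext : ℕ → ℕ → Bool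
        pascalNext u = pascalSum τ 0 (addCarry true (bits ℓ u))

      agree-inside : ∀ {a} → a < ℓ → r + a < m → pascalBits s (r + a) ≡ pascalBits s′ (r + a)
      agree-inside {a} a<ℓ r+a<m = xor-cancelˡ (affine (r + a)) _ _
        (trans (sym (window-inside s<P a<ℓ r+a<m)) (trans (cong (_‼ a) same) (window-inside s′<P a<ℓ r+a<m)))

      agree-across : ∀ {a} → a < ℓ → m ≤ r + a → pascalNext s (r + a ∸ m) ≡ pascalNext s′ (r + a ∸ m)
      agree-across {a} a<ℓ m≤r+a = xor-cancelˡ (affine (r + a ∸ m)) _ _
        (trans (sym (window-across r<m s<P a<ℓ m≤r+a)) (trans (cong (_‼ a) same) (window-across r<m s′<P a<ℓ m≤r+a)))

      bits-inside : r + ℓ ≤ m → bits ℓ s ≡ bits ℓ s′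
      bits-inside r+ℓ≤m = pascalSum-window-injective τ (bits ℓ s) (bits ℓ s′)
        (trans (length-bits ℓ s) (sym (length-bits ℓ s′))) r
        (subst (AgreeOn (pascalBits s) (pascalBits s′) r) (sym (length-bits ℓ s))
          (agreeOn λ a a<ℓ → agree-inside a<ℓ (<-≤-trans (+-monoʳ-< r a<ℓ) r+ℓ≤m)))

      bits-across : m < r + ℓ → bits ℓ s ≡ bits ℓ s′
      bits-across m<r+ℓ = wrap-around d (admissible-staircase adm ℓ≤m) ℓ≤m a₀ h (m+[n∸m]≡n (<⇒≤ a₀<ℓ)) true
                            (bits ℓ s) (bits ℓ s′) (length-bits ℓ s) (length-bits ℓ s′) top bottom
        where
        a₀ = m ∸ r
        h = ℓ ∸ a₀
        r+a₀≡m : r + a₀ ≡ m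
        r+a₀≡m = m+[n∸m]≡n (<⇒≤ r<m)
        a₀<ℓ : a₀ < ℓ
        a₀<ℓ = +-cancelˡ-< r a₀ ℓ (subst (_< r + ℓ) (sym r+a₀≡m) m<r+ℓ)
        top : AgreeOn (pascalBits s) (pascalBits s′) (m ∸ a₀) a₀
        top = subst (λ lo → AgreeOn (pascalBits s) (pascalBits s′) lo a₀) (sym (m∸[m∸n]≡n (<⇒≤ r<m)))
          (agreeOn λ j j<a₀ → agree-inside (<-trans j<a₀ a₀<ℓ) (subst (r + j <_) r+a₀≡m (+-monoʳ-< r j<a₀)))
        r+[a₀+j]≡m+j : ∀ j → r + (a₀ + j) ≡ m + j
        r+[a₀+j]≡m+j j = trans (sym (+-assoc r a₀ j)) (cong (_+ j) r+a₀≡m)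
        bottom : AgreeOn (pascalNext s) (pascalNext s′) 0 h
        bottom = agreeOn λ j j<h →
          subst (λ i → pascalNext s i ≡ pascalNext s′ i) (trans (cong (_∸ m) (r+[a₀+j]≡m+j j)) (m+n∸m≡n m j))
            (agree-across (subst (a₀ + j <_) (m+[n∸m]≡n (<⇒≤ a₀<ℓ)) (+-monoʳ-< a₀ j<h))
                          (subst (m ≤_) (sym (r+[a₀+j]≡m+j j)) (m≤m+n m j)))

    window-injective : ∀ r {s s′} → r < m → s < P → s′ < P →
      window factor ℓ (s * m + r) ≡ window factor ℓ (s′ * m + r) → s ≡ s′
    window-injective r {s} {s′} r<m s<P s′<P same = bits-injective ℓ s<P s′<P (by-cases (r + ℓ ≤? m))
      where
      by-cases : Dec (r + ℓ ≤ m) → bits ℓ s ≡ bits ℓ s′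
      by-cases (yes r+ℓ≤m) = bits-inside r<m s<P s′<P same r+ℓ≤m
      by-cases (no  r+ℓ≰m) = bits-across r<m s<P s′<P same (≰⇒> r+ℓ≰m)

    factor-perfect : PerfectNecklace ℓ m factor
    factor-perfect = perfectNecklace-criterion m ℓ {{m^n≢0 2 d}} factor length-factor window-injective

  affineNecklace-nested : NestedPerfectNecklace k m w
  affineNecklace-nested = length-affineNecklace , λ ℓ _ ℓ≤k t fits → Factor.factor-perfect ℓ t ℓ≤k fits

proposition7 : (d k : ℕ) → 1 ≤ k → k ≤ 2 ^ d →
    (ns : ℕ → ℕ) → Admissible (2 ^ d) ns →
    (z : Vec Bool (2 ^ d)) →
    NestedPerfectNecklace k (2 ^ d) (affineNecklace d k ns z)
proposition7 d k _ k≤m ns adm z = affineNecklace-nested d k k≤m adm z
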